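{- Let $k\ge1$, $m=2^{k-1}$, $r\ge0$, $n=2^r$, and $I=(i_1,\dots,i_k)$ nonnegative integers with $i_1+2i_2+\dots+k\,i_k=r$. The code $\mathcal D_I=\mathcal H_I^\perp$ is a linear $(n,\,n2^k,\,n2^{k-2})^*$-code with generator matrix $B_I$, and the corresponding $Z_{2^k}$-linear code $D_I=\varphi(\mathcal D_I)$ is a binary $(n2^{k-1},\,n2^k,\,n2^{k-2})$-code, i.e. a Hadamard code.
   Context: $B_I$ is the matrix whose columns are all elements of $\{1\}\times(2^{k-1}Z_{2^k})^{i_1}\times\dots\times(2^0Z_{2^k})^{i_k}$ in lexicographic order, and $\mathcal H_I=\{\bar h\in Z_{2^k}^n:B_I\bar h^T=\bar0\}$; $\perp$ denotes the dual with respect to $\sum_ix_iy_i$. Define $wt^*(0)=0$, $wt^*(m)=m$, $wt^*(x)=m/2$ otherwise on $Z_{2^k}$, $d^*(\bar x,\bar y)=\sum_iwt^*(y_i-x_i)$; an $(n,M,d)^*$-code is a subset of $Z_{2^k}^n$ of size $M$ with pairwise $d^*$-distance at least $d$. Let $A=\{a_0,\dots,a_{2m-1}\}\subset Z_2^m$ be a binary $(m,2m,m/2)$-code with $a_0=\bar0$ and $a_i+a_{i+m}$ the all-one word for $0\le i<m$; $\varphi(x_1,\dots,x_n)=(a_{x_1},\dots,a_{x_n})$ and $\varphi(\mathcal C)=\{\varphi(\bar x):\bar x\in\mathcal C\}$. A binary $(N,M,d)$-code is a subset of $Z_2^N$ of size $M$ with pairwise Hamming distance at least $d$. -}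

module Defs where

open import Data.Nat using (ℕ; zero; suc; _+_; _*_; _∸_; _^_; NonZero; _≟_)
open import Data.Nat.DivMod using (_%_; m%n<n)
open import Data.Nat.Properties using (m^n≢0)
open import Data.Fin using (Fin; toℕ; fromℕ<)
open import Data.Bool using (Bool; true; false; _xor_; if_then_else_)
open import Data.Vec using (Vec; []; _∷_; zipWith; replicate)
open import Data.List using (List; []; _∷_; upTo; concatMap; map; length; _++_)
open import Relation.Nullary using (yes; no)

Zq : ℕ → Set
Zq k = Fin (2 ^ k)

[_]q : (k : ℕ) → ℕ → Zq k
[ k ]q x = fromℕ< (m%n<n x (2 ^ k) {{m^n≢0 2 k}})

0q : (k : ℕ) → Zq k
0q k = [ k ]q 0

1q : (k : ℕ) → Zq k
1q k = [ k ]q 1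

addq : (k : ℕ) → Zq k → Zq k → Zq k
addq k x y = [ k ]q (toℕ x + toℕ y)

mulq : (k : ℕ) → Zq k → Zq k → Zq k
mulq k x y = [ k ]q (toℕ x * toℕ y)

subq : (k : ℕ) → Zq k → Zq k → Zq k
subq k y x = [ k ]q (toℕ y + (2 ^ k ∸ toℕ x))

vadd : (k : ℕ) {N : ℕ} → Vec (Zq k) N → Vec (Zq k) N → Vec (Zq k) N
vadd k = zipWith (addq k)

vscale : (k : ℕ) {N : ℕ} → Zq k → Vec (Zq k) N → Vec (Zq k) N
vscale k a [] = []
vscale k a (x ∷ xs) = mulq k a x ∷ vscale k a xs

dot : (k : ℕ) {N : ℕ} → Vec (Zq k) N → Vec (Zq k) N → Zq k
dot k [] [] = 0q k
dot k (x ∷ xs) (y ∷ ys) = addq k (mulq k x y) (dot k xs ys)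

weighted' : {k : ℕ} → ℕ → Vec ℕ k → ℕ
weighted' j [] = 0
weighted' j (i ∷ is) = j * i + weighted' (suc j) is

weighted : {k : ℕ} → Vec ℕ k → ℕ
weighted = weighted' 1

-- the list of "levels" of the non-constant rows of B_I:
-- level j (1 ≤ j ≤ k) repeated i_j times, rows with entries in 2^{k-j} Z_{2^k}
replicateL : ℕ → ℕ → List ℕ
replicateL zero j = []
replicateL (suc i) j = j ∷ replicateL i j

levels' : {k : ℕ} → ℕ → Vec ℕ k → List ℕ
levels' j [] = []
levels' j (i ∷ is) = replicateL i j ++ levels' (suc j) is

levels : {k : ℕ} → Vec ℕ k → List ℕ
levels = levels' 1

tuples : (k : ℕ) (ls : List ℕ) → List (Vec (Zq k) (length ls))
tuples k [] = [] ∷ []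
tuples k (j ∷ ls) =
  concatMap (λ t → map ([ k ]q (2 ^ (k ∸ j) * t) ∷_) (tuples k ls)) (upTo (2 ^ j))

rowsB : {k : ℕ} → Vec ℕ k → ℕ
rowsB I = suc (length (levels I))

-- the columns of B_I, in lexicographic order: {1} × (2^{k-1}Z)^{i_1} × ... × (2^0 Z)^{i_k}
columnsB : (k : ℕ) (I : Vec ℕ k) → List (Vec (Zq k) (rowsB I))
columnsB k I = map (1q k ∷_) (tuples k (levels I))

lenB : (k : ℕ) (I : Vec ℕ k) → ℕ
lenB k I = length (columnsB k I)

-- matrix-vector product  M h^T  for a matrix given by its list of columns
matVec : (k : ℕ) {R : ℕ} (cols : List (Vec (Zq k) R)) → Vec (Zq k) (length cols) → Vec (Zq k) R
matVec k [] [] = replicate _ (0q k)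
matVec k (c ∷ cs) (h ∷ hs) = vadd k (vscale k h c) (matVec k cs hs)

vecMat : (k : ℕ) {R : ℕ} (cols : List (Vec (Zq k) R)) → Vec (Zq k) R → Vec (Zq k) (length cols)
vecMat k [] c = []
vecMat k (col ∷ cs) c = dot k c col ∷ vecMat k cs c

HI : (k : ℕ) (I : Vec ℕ k) → Vec (Zq k) (lenB k I) → Set
HI k I h = matVec k (columnsB k I) h ≡ replicate _ (0q k)
  where open import Relation.Binary.PropositionalEquality using (_≡_)

DI : (k : ℕ) (I : Vec ℕ k) → Vec (Zq k) (lenB k I) → Set
DI k I x = (h : Vec (Zq k) (lenB k I)) → HI k I h → dot k x h ≡ 0q k
  where open import Relation.Binary.PropositionalEquality using (_≡_)

-- Distances.  To avoid fractions, we use TWICE the weights/distances.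

wt2 : (k : ℕ) → Zq k → ℕ
wt2 k x with toℕ x ≟ 0
... | yes _ = 0
... | no _ with toℕ x ≟ 2 ^ (k ∸ 1)
...   | yes _ = 2 * 2 ^ (k ∸ 1)
...   | no _ = 2 ^ (k ∸ 1)

dist2 : (k : ℕ) {N : ℕ} → Vec (Zq k) N → Vec (Zq k) N → ℕ
dist2 k [] [] = 0
dist2 k (x ∷ xs) (y ∷ ys) = wt2 k (subq k y x) + dist2 k xs ys

hamming : {N : ℕ} → Vec Bool N → Vec Bool N → ℕ
hamming [] [] = 0
hamming (x ∷ xs) (y ∷ ys) = (if x xor y then 1 else 0) + hamming xs ys

φ : (k : ℕ) {N : ℕ} → (Zq k → Vec Bool (2 ^ (k ∸ 1))) →
    Vec (Zq k) N → Vec Bool (N * 2 ^ (k ∸ 1))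
φ k A [] = []
φ k A (x ∷ xs) = A x Data.Vec.++ φ k A xs
  where import Data.Vec

module Submission where

-- The columns of B_I are the vectors (1, g), g ranging over the grid
-- T = ∏ 2^(k-j) Z_{2^k} (one factor per level j of I), so H_I^⊥ consists of the
-- functions on T killed by every affine relation among points of T.  Three
-- kinds of relations, [a t, g] - [a t, 0] - [a 0, g] + [a 0, 0],
-- [a t] - t [a 1] + (t - 1) [a 0] and N [a 1] - N [a 0], force such a function
-- to be affine, g ↦ d + c·g, with c unique once its level-j entries are reduced
-- modulo 2^j; this gives the generator matrix and |D_I| = 2^k 2^r.  A nonzero
-- difference of codewords is g ↦ e + c·g: if c·g vanishes on T its weight is
-- n wt*(e) ≥ n m/2; otherwise along a coordinate it runs through full cosets of
-- a nontrivial subgroup, on which v and v + m have weights summing to m, so the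
-- weight is exactly n m/2.  Finally wt*(y - x) ≤ d_H(a_x, a_y) coordinatewise,
-- since A has distance m/2 and a_x, a_(x+m) are complementary.  Weights and
-- distances are doubled throughout, as in the statement.

open import Defs
open import Data.Nat using (ℕ; zero; suc; s≤s⁻¹; _+_; _*_; _∸_; _^_; _≤_; _<_; _≤?_; _<?_; _≟_; z≤n; s≤s; NonZero)
open import Data.Nat.Properties
open import Data.Nat.DivMod using (_%_; _/_; [m+n]%n≡m%n; m%n<n; [m+kn]%n≡m%n; m≡m%n+[m/n]*n; m*n%n≡0; m<n*o⇒m/o<n; m*[n/m]≡n; %-distribˡ-+; %-distribˡ-*; m%n%n≡m%n; m<n⇒m%n≡m; m%n≤n; n%n≡0)
open import Data.Fin using (Fin; toℕ; fromℕ<)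
open import Data.Fin.Properties using (toℕ-fromℕ<; fromℕ<-cong; toℕ-injective; toℕ<n)
import Data.Fin as Fin
open import Data.Integer as ℤ using (ℤ; -[1+_]; _⊖_)
import Data.Integer.Properties as ℤ
open import Data.Bool using (Bool; true; false; _xor_; if_then_else_)
open import Data.Bool.Properties using (xor-comm)
open import Data.Vec as Vec using (Vec; []; _∷_; replicate; zipWith)
import Data.Vec.Properties as Vec
open import Data.List as List using (List; []; _∷_; map; length; allFin; _++_; concatMap; applyUpTo; upTo; cartesianProductWith)
open import Data.List.Properties using (length-++; length-map; length-tabulate; length-applyUpTo; length-upTo; map-upTo)
open import Data.List.Membership.Propositional using (_∈_; _∉_)
open import Data.List.Relation.Unary.Any using (here; there)
open import Data.List.Relation.Unary.All as All using (All; []; _∷_)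
import Data.List.Relation.Unary.All.Properties as All
import Data.List.Relation.Unary.Unique.Propositional.Properties as Unique
open import Data.List.Membership.Propositional.Properties using (∈-cartesianProductWith⁺; ∈-cartesianProductWith⁻; ∈-applyUpTo⁺; ∈-applyUpTo⁻; ∈-map⁺; ∈-map⁻; ∈-allFin)
open import Data.List.Relation.Unary.Unique.Propositional using (Unique; []; _∷_)
open import Data.Maybe using (Maybe; just; nothing)
open import Data.Product using (Σ; ∃; _×_; _,_; proj₁; proj₂; uncurry)
open import Function.Bundles using (_⇔_; mk⇔)
open import Data.Sum using (_⊎_; inj₁; inj₂)
open import Data.Nat.Tactic.RingSolver using (solve-∀)
open import Data.Nat.ListAction using (sum)
open import Data.Nat.ListAction.Properties using (sum-++)
open import Data.Nat.Divisibility using (_∣_; m%n≡0⇒n∣m; *-cancelˡ-∣)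
open import Data.Empty using (⊥; ⊥-elim)
open import Function using (_∘_; id)
open import Algebra.Core using (Op₂)
open import Algebra.Bundles using (CommutativeRing; CommutativeSemigroup)
open import Algebra.Structures using (IsCommutativeSemiring; IsCommutativeRing)
import Algebra.Properties.Ring as RingProperties
import Algebra.Properties.AbelianGroup as AbelianGroupProperties
open import Algebra.Solver.Ring.AlmostCommutativeRing using (fromCommutativeRing; _-Raw-AlmostCommutative⟶_)
open import Relation.Binary.Definitions using (DecidableEquality)
open import Relation.Binary.PropositionalEquality hiding ([_])
open import Relation.Nullary using (Dec; yes; no)

private variable
  X Y V : Set

module _ (f : X → Y → V) where

  concatMap-map≡cartesianProductWith : ∀ {U : Set} (g : U → X) xs (ys : List Y) →
    concatMap (λ x → map (f (g x)) ys) xs ≡ cartesianProductWith f (map g xs) ys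
  concatMap-map≡cartesianProductWith g [] ys = refl
  concatMap-map≡cartesianProductWith g (x ∷ xs) ys =
    cong (map (f (g x)) ys ++_) (concatMap-map≡cartesianProductWith g xs ys)

  length-cartesianProductWith : ∀ xs ys → length (cartesianProductWith f xs ys) ≡ length xs * length ys
  length-cartesianProductWith [] ys = refl
  length-cartesianProductWith (x ∷ xs) ys =
    trans (length-++ (map (f x) ys)) (cong₂ _+_ (length-map (f x) ys) (length-cartesianProductWith xs ys))

∈-map-elim : ∀ {f : X → Y} {xs} (P : Y → Set) → (∀ {x} → x ∈ xs → P (f x)) → ∀ {y} → y ∈ map f xs → P y
∈-map-elim {f = f} P P-f y∈ with x , x∈ , refl ← ∈-map⁻ f y∈ = P-f x∈

cartesianCons : ∀ {n} (N : ℕ) (f : ℕ → X) → List (Vec X n) → List (Vec X (suc n))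
cartesianCons N f vs = cartesianProductWith _∷_ (applyUpTo f N) vs

module _ {n : ℕ} (N : ℕ) (f : ℕ → X) (vs : List (Vec X n)) where

  ∈-cartesianCons⁺ : ∀ {t v} → t < N → v ∈ vs → (f t ∷ v) ∈ cartesianCons N f vs
  ∈-cartesianCons⁺ t<N v∈vs = ∈-cartesianProductWith⁺ _∷_ (∈-applyUpTo⁺ f t<N) v∈vs

  ∈-cartesianCons⁻ : ∀ {w} → w ∈ cartesianCons N f vs → ∃ λ t → ∃ λ v → t < N × v ∈ vs × w ≡ f t ∷ v
  ∈-cartesianCons⁻ w∈ with ∈-cartesianProductWith⁻ _∷_ (applyUpTo f N) vs w∈
  ... | x , v , x∈ , v∈vs , refl with ∈-applyUpTo⁻ f x∈
  ...   | t , t<N , refl = t , v , t<N , v∈vs , refl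

  length-cartesianCons : length (cartesianCons N f vs) ≡ N * length vs
  length-cartesianCons = trans (length-cartesianProductWith _∷_ (applyUpTo f N) vs)
                               (cong (_* length vs) (length-applyUpTo f N))

  cartesianCons-unique : (∀ {s t} → s < t → t < N → f s ≢ f t) → Unique vs → Unique (cartesianCons N f vs)
  cartesianCons-unique f-inj vs! =
    Unique.cartesianProductWith⁺ _∷_ Vec.∷-injective (Unique.applyUpTo⁺₁ f N f-inj) vs!

Unique-map⁺-injectiveOn : ∀ (f : X → Y) {xs} → Unique xs →
  (∀ {x y} → x ∈ xs → y ∈ xs → f x ≡ f y → x ≡ y) → Unique (map f xs)
Unique-map⁺-injectiveOn f [] inj = []
Unique-map⁺-injectiveOn f (x∉xs ∷ xs!) inj =
  All.map⁺ (All.tabulate (λ y∈xs fx≡fy → All.lookup x∉xs y∈xs (inj (here refl) (there y∈xs) fx≡fy)))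
  ∷ Unique-map⁺-injectiveOn f xs! (λ x∈ y∈ → inj (there x∈) (there y∈))

lookup-ext : ∀ {n} (u v : Vec X n) → (∀ i → Vec.lookup u i ≡ Vec.lookup v i) → u ≡ v
lookup-ext u v u≗v = trans (sym (Vec.tabulate∘lookup u)) (trans (Vec.tabulate-cong u≗v) (Vec.tabulate∘lookup v))

tabulateOn : (xs : List X) → (X → Y) → Vec Y (length xs)
tabulateOn [] F = []
tabulateOn (x ∷ xs) F = F x ∷ tabulateOn xs F

tabulateOn-cong : ∀ (xs : List X) {F G : X → Y} → (∀ {x} → x ∈ xs → F x ≡ G x) →
  tabulateOn xs F ≡ tabulateOn xs G
tabulateOn-cong [] F≗G = refl
tabulateOn-cong (x ∷ xs) F≗G = cong₂ _∷_ (F≗G (here refl)) (tabulateOn-cong xs (F≗G ∘ there))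

tabulateOn-injective : ∀ (xs : List X) {F G : X → Y} → tabulateOn xs F ≡ tabulateOn xs G →
  ∀ {x} → x ∈ xs → F x ≡ G x
tabulateOn-injective (x ∷ xs) e (here refl) = Vec.∷-injectiveˡ e
tabulateOn-injective (x ∷ xs) e (there x∈xs) = tabulateOn-injective xs (Vec.∷-injectiveʳ e) x∈xs

module _ (_≟_ : DecidableEquality X) (default : Y) where

  -- junk value default at positions x ∉ xs
  entryAt : (xs : List X) → Vec Y (length xs) → X → Y
  entryAt [] [] x = default
  entryAt (y ∷ xs) (v ∷ vs) x with x ≟ y
  ... | yes _ = v
  ... | no _ = entryAt xs vs x

  tabulateOn-entryAt : ∀ {xs : List X} (v : Vec Y (length xs)) → Unique xs → tabulateOn xs (entryAt xs v) ≡ v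
  tabulateOn-entryAt {[]} [] [] = refl
  tabulateOn-entryAt {y ∷ xs} (v ∷ vs) (y∉xs ∷ xs!) =
    cong₂ _∷_ head (trans (tabulateOn-cong xs tail) (tabulateOn-entryAt vs xs!))
    where
    head : entryAt (y ∷ xs) (v ∷ vs) y ≡ v
    head with y ≟ y
    ... | yes _ = refl
    ... | no y≢y = ⊥-elim (y≢y refl)
    tail : ∀ {x} → x ∈ xs → entryAt (y ∷ xs) (v ∷ vs) x ≡ entryAt xs vs x
    tail {x} x∈xs with x ≟ y
    ... | yes refl = ⊥-elim (All.lookup y∉xs x∈xs refl)
    ... | no _ = refl

module ListSum {A : Set} {_⊕_ _⊗_ : Op₂ A} {0# 1# : A}
  (isCommutativeSemiring : IsCommutativeSemiring _≡_ _⊕_ _⊗_ 0# 1#) where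

  open IsCommutativeSemiring isCommutativeSemiring
    using (zeroˡ; zeroʳ; distribˡ)
    renaming (+-identityˡ to ⊕-identityˡ; +-identityʳ to ⊕-identityʳ; +-assoc to ⊕-assoc;
              *-identityˡ to ⊗-identityˡ)
  ⊕-commutativeSemigroup : CommutativeSemigroup _ _
  ⊕-commutativeSemigroup = record { isCommutativeSemigroup = IsCommutativeSemiring.+-isCommutativeSemigroup isCommutativeSemiring }

  open import Algebra.Properties.CommutativeSemigroup ⊕-commutativeSemigroup
    using () renaming (interchange to ⊕-interchange)
  open ≡-Reasoning

  ∑ : List X → (X → A) → A
  ∑ [] F = 0#
  ∑ (x ∷ xs) F = F x ⊕ ∑ xs F

  ∑-cong : ∀ (xs : List X) {F G : X → A} → (∀ {x} → x ∈ xs → F x ≡ G x) → ∑ xs F ≡ ∑ xs G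
  ∑-cong [] F≗G = refl
  ∑-cong (x ∷ xs) F≗G = cong₂ _⊕_ (F≗G (here refl)) (∑-cong xs (λ x∈ → F≗G (there x∈)))

  ∑-zero : ∀ (xs : List X) {F : X → A} → (∀ {x} → x ∈ xs → F x ≡ 0#) → ∑ xs F ≡ 0#
  ∑-zero xs {F} F≗0 = trans (∑-cong xs F≗0) (∑-0 xs)
    where
    ∑-0 : ∀ (xs : List X) → ∑ xs (λ _ → 0#) ≡ 0#
    ∑-0 [] = refl
    ∑-0 (x ∷ xs) = trans (cong (0# ⊕_) (∑-0 xs)) (⊕-identityˡ 0#)

  ∑-++ : ∀ (xs ys : List X) (F : X → A) → ∑ (xs ++ ys) F ≡ ∑ xs F ⊕ ∑ ys F
  ∑-++ [] ys F = sym (⊕-identityˡ _)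
  ∑-++ (x ∷ xs) ys F = trans (cong (F x ⊕_) (∑-++ xs ys F)) (sym (⊕-assoc (F x) (∑ xs F) (∑ ys F)))

  ∑-map : ∀ (xs : List X) (f : X → Y) (F : Y → A) → ∑ (map f xs) F ≡ ∑ xs (λ x → F (f x))
  ∑-map [] f F = refl
  ∑-map (x ∷ xs) f F = cong (F (f x) ⊕_) (∑-map xs f F)

  ∑-cartesianProductWith : ∀ (f : X → Y → V) xs ys (F : V → A) →
    ∑ (cartesianProductWith f xs ys) F ≡ ∑ xs (λ x → ∑ ys (λ y → F (f x y)))
  ∑-cartesianProductWith f [] ys F = refl
  ∑-cartesianProductWith f (x ∷ xs) ys F = begin
    ∑ (map (f x) ys ++ cartesianProductWith f xs ys) F          ≡⟨ ∑-++ (map (f x) ys) _ F ⟩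
    ∑ (map (f x) ys) F ⊕ ∑ (cartesianProductWith f xs ys) F     ≡⟨ cong₂ _⊕_ (∑-map ys (f x) F)
                                                                     (∑-cartesianProductWith f xs ys F) ⟩
    ∑ ys (λ y → F (f x y)) ⊕ ∑ xs (λ x → ∑ ys (λ y → F (f x y))) ∎

  ∑-⊕ : ∀ (xs : List X) (F G : X → A) → ∑ xs (λ x → F x ⊕ G x) ≡ ∑ xs F ⊕ ∑ xs G
  ∑-⊕ [] F G = sym (⊕-identityˡ 0#)
  ∑-⊕ (x ∷ xs) F G = trans (cong ((F x ⊕ G x) ⊕_) (∑-⊕ xs F G)) (⊕-interchange (F x) (G x) (∑ xs F) (∑ xs G))

  ∑-⊗ˡ : ∀ (xs : List X) (c : A) (F : X → A) → ∑ xs (λ x → c ⊗ F x) ≡ c ⊗ ∑ xs F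
  ∑-⊗ˡ [] c F = sym (zeroʳ c)
  ∑-⊗ˡ (x ∷ xs) c F = trans (cong ((c ⊗ F x) ⊕_) (∑-⊗ˡ xs c F)) (sym (distribˡ c (F x) (∑ xs F)))

  ∑-applyUpTo : ∀ (f : ℕ → X) n (F : X → A) → ∑ (applyUpTo f n) F ≡ ∑ (upTo n) (λ t → F (f t))
  ∑-applyUpTo f n F = trans (cong (λ xs → ∑ xs F) (sym (map-upTo f n))) (∑-map (upTo n) f F)

  ∑-upTo-+ : ∀ a b (F : ℕ → A) → ∑ (upTo (a + b)) F ≡ ∑ (upTo a) F ⊕ ∑ (upTo b) (λ t → F (a + t))
  ∑-upTo-+ a b F = trans (split id a) (cong (∑ (upTo a) F ⊕_) (∑-applyUpTo (a +_) b F))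
    where
    split : ∀ (f : ℕ → ℕ) a → ∑ (applyUpTo f (a + b)) F ≡ ∑ (applyUpTo f a) F ⊕ ∑ (applyUpTo (λ t → f (a + t)) b) F
    split f zero = sym (⊕-identityˡ _)
    split f (suc a) = trans (cong (F (f 0) ⊕_) (split (f ∘ suc) a)) (sym (⊕-assoc (F (f 0)) _ _))

  ∑-cartesianCons : ∀ {n} N (f : ℕ → X) (vs : List (Vec X n)) (F : Vec X (suc n) → A) →
    ∑ (cartesianCons N f vs) F ≡ ∑ (upTo N) (λ t → ∑ vs (λ v → F (f t ∷ v)))
  ∑-cartesianCons N f vs F = trans (∑-cartesianProductWith _∷_ (applyUpTo f N) vs F)
                                   (∑-applyUpTo f N (λ x → ∑ vs (λ v → F (x ∷ v))))

  module _ (_≟_ : DecidableEquality X) where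

    indicator : X → X → A
    indicator v x with x ≟ v
    ... | yes _ = 1#
    ... | no _ = 0#

    ∑-indicator : ∀ {xs : List X} v (F : X → A) → Unique xs → v ∈ xs → ∑ xs (λ x → indicator v x ⊗ F x) ≡ F v
    ∑-indicator {x ∷ xs} v F (x∉xs ∷ xs!) v∈x∷xs with x ≟ v | v∈x∷xs
    ... | yes refl | _ = trans (cong₂ _⊕_ (⊗-identityˡ (F v)) (∑-zero xs off)) (⊕-identityʳ (F v))
      where
      off : ∀ {y} → y ∈ xs → indicator v y ⊗ F y ≡ 0#
      off {y} y∈xs with y ≟ v
      ... | yes refl = ⊥-elim (All.lookup x∉xs y∈xs refl)
      ... | no _ = zeroˡ (F y)
    ... | no x≢v | here v≡x = ⊥-elim (x≢v (sym v≡x))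
    ... | no _ | there v∈xs = trans (cong (_⊕ ∑ xs (λ y → indicator v y ⊗ F y)) (zeroˡ (F x)))
                                 (trans (⊕-identityˡ _) (∑-indicator v F xs! v∈xs))

parity : ∀ c → c ≡ c / 2 * 2 ⊎ c ≡ 1 + c / 2 * 2
parity c with c % 2 | m%n<n c 2 | m≡m%n+[m/n]*n c 2
... | 0 | _ | c≡ = inj₁ c≡
... | 1 | _ | c≡ = inj₂ c≡
... | suc (suc _) | s≤s (s≤s ()) | _

module ℕ-Sum = ListSum +-*-isCommutativeSemiring

∑-const : ∀ {X : Set} (xs : List X) (c : ℕ) → ℕ-Sum.∑ xs (λ _ → c) ≡ length xs * c
∑-const [] c = refl
∑-const (x ∷ xs) c = cong (c +_) (∑-const xs c)

module ZMod (k : ℕ) where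

  M : ℕ
  M = 2 ^ k

  instance
    M≢0 : NonZero M
    M≢0 = m^n≢0 2 k

  Z : Set
  Z = Zq k

  [_] : ℕ → Z
  [_] = [ k ]q

  toℕ-[] : ∀ a → toℕ [ a ] ≡ a % M
  toℕ-[] a = toℕ-fromℕ< _

  []-cong : ∀ {a b} → a % M ≡ b % M → [ a ] ≡ [ b ]
  []-cong e = fromℕ<-cong _ _ e _ _

  []-toℕ : ∀ x → [ toℕ x ] ≡ x
  []-toℕ x = toℕ-injective (trans (toℕ-[] (toℕ x)) (m<n⇒m%n≡m (toℕ<n x)))

  []-% : ∀ a → [ a % M ] ≡ [ a ]
  []-% a = []-cong (m%n%n≡m%n a M)

  []-%ˡ : ∀ a b → [ a % M + b ] ≡ [ a + b ]
  []-%ˡ a b = []-cong (begin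
    (a % M + b) % M           ≡⟨ %-distribˡ-+ (a % M) b M ⟩
    (a % M % M + b % M) % M   ≡⟨ cong (λ u → (u + b % M) % M) (m%n%n≡m%n a M) ⟩
    (a % M + b % M) % M       ≡⟨ %-distribˡ-+ a b M ⟨
    (a + b) % M               ∎)
    where open ≡-Reasoning

  []-%ʳ : ∀ a b → [ a + b % M ] ≡ [ a + b ]
  []-%ʳ a b = begin
    [ a + b % M ]  ≡⟨ cong [_] (+-comm a _) ⟩
    [ b % M + a ]  ≡⟨ []-%ˡ b a ⟩
    [ b + a ]      ≡⟨ cong [_] (+-comm b a) ⟩
    [ a + b ]      ∎
    where open ≡-Reasoning

  []-injective-< : ∀ {a b} → a < M → b < M → [ a ] ≡ [ b ] → a ≡ b
  []-injective-< {a} {b} a<M b<M e = begin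
    a           ≡⟨ m<n⇒m%n≡m a<M ⟨
    a % M       ≡⟨ toℕ-[] a ⟨
    toℕ [ a ]   ≡⟨ cong toℕ e ⟩
    toℕ [ b ]   ≡⟨ toℕ-[] b ⟩
    b % M       ≡⟨ m<n⇒m%n≡m b<M ⟩
    b           ∎
    where open ≡-Reasoning

  infixl 6 _+z_
  infixl 7 _*z_
  infix 8 -z_

  _+z_ _*z_ : Z → Z → Z
  _+z_ = addq k
  _*z_ = mulq k

  -z_ : Z → Z
  -z x = [ M ∸ toℕ x ]

  0z 1z : Z
  0z = 0q k
  1z = 1q k

  [+] : ∀ a b → [ a ] +z [ b ] ≡ [ a + b ]
  [+] a b = begin
    [ toℕ [ a ] + toℕ [ b ] ] ≡⟨ cong₂ (λ u v → [ u + v ]) (toℕ-[] a) (toℕ-[] b) ⟩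
    [ a % M + b % M ]         ≡⟨ []-%ˡ a _ ⟩
    [ a + b % M ]             ≡⟨ []-%ʳ a b ⟩
    [ a + b ]                 ∎
    where open ≡-Reasoning

  [*] : ∀ a b → [ a ] *z [ b ] ≡ [ a * b ]
  [*] a b = begin
    [ toℕ [ a ] * toℕ [ b ] ] ≡⟨ cong₂ (λ u v → [ u * v ]) (toℕ-[] a) (toℕ-[] b) ⟩
    [ a % M * (b % M) ]       ≡⟨ []-cong (trans (%-distribˡ-* (a % M) (b % M) M)
                                   (trans (cong₂ (λ u v → (u * v) % M) (m%n%n≡m%n a M) (m%n%n≡m%n b M))
                                     (sym (%-distribˡ-* a b M)))) ⟩
    [ a * b ]                 ∎
    where open ≡-Reasoning

  -[] : ∀ a → -z [ a ] ≡ [ M ∸ a % M ]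
  -[] a = cong (λ u → [ M ∸ u ]) (toℕ-[] a)

  -- Every element is [ a ] for some a, so the ring laws reduce to those of ℕ.
  []-elim : ∀ {P : Z → Set} → (∀ a → P [ a ]) → ∀ x → P x
  []-elim {P} f x = subst P ([]-toℕ x) (f (toℕ x))

  []-elim₂ : ∀ {P : Z → Z → Set} → (∀ a b → P [ a ] [ b ]) → ∀ x y → P x y
  []-elim₂ {P} f = []-elim (λ a → []-elim (f a))

  []-elim₃ : ∀ {P : Z → Z → Z → Set} → (∀ a b c → P [ a ] [ b ] [ c ]) → ∀ x y z → P x y z
  []-elim₃ {P} f = []-elim (λ a → []-elim₂ (f a))

  +z-assoc : ∀ x y z → (x +z y) +z z ≡ x +z (y +z z)
  +z-assoc = []-elim₃ λ a b c → begin
    ([ a ] +z [ b ]) +z [ c ] ≡⟨ cong (_+z [ c ]) ([+] a b) ⟩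
    [ a + b ] +z [ c ]        ≡⟨ [+] (a + b) c ⟩
    [ a + b + c ]             ≡⟨ cong [_] (+-assoc a b c) ⟩
    [ a + (b + c) ]           ≡⟨ [+] a (b + c) ⟨
    [ a ] +z [ b + c ]        ≡⟨ cong ([ a ] +z_) ([+] b c) ⟨
    [ a ] +z ([ b ] +z [ c ]) ∎
    where open ≡-Reasoning

  *z-assoc : ∀ x y z → (x *z y) *z z ≡ x *z (y *z z)
  *z-assoc = []-elim₃ λ a b c → begin
    ([ a ] *z [ b ]) *z [ c ] ≡⟨ cong (_*z [ c ]) ([*] a b) ⟩
    [ a * b ] *z [ c ]        ≡⟨ [*] (a * b) c ⟩
    [ a * b * c ]             ≡⟨ cong [_] (*-assoc a b c) ⟩
    [ a * (b * c) ]           ≡⟨ [*] a (b * c) ⟨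
    [ a ] *z [ b * c ]        ≡⟨ cong ([ a ] *z_) ([*] b c) ⟨
    [ a ] *z ([ b ] *z [ c ]) ∎
    where open ≡-Reasoning

  +z-comm : ∀ x y → x +z y ≡ y +z x
  +z-comm x y = cong [_] (+-comm (toℕ x) (toℕ y))

  *z-comm : ∀ x y → x *z y ≡ y *z x
  *z-comm x y = cong [_] (*-comm (toℕ x) (toℕ y))

  +z-identityˡ : ∀ x → 0z +z x ≡ x
  +z-identityˡ = []-elim ([+] 0)

  +z-identityʳ : ∀ x → x +z 0z ≡ x
  +z-identityʳ x = trans (+z-comm x 0z) (+z-identityˡ x)

  *z-identityˡ : ∀ x → 1z *z x ≡ x
  *z-identityˡ = []-elim λ a → trans ([*] 1 a) (cong [_] (*-identityˡ a))

  *z-identityʳ : ∀ x → x *z 1z ≡ x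
  *z-identityʳ x = trans (*z-comm x 1z) (*z-identityˡ x)

  *z-distribˡ-+z : ∀ x y z → x *z (y +z z) ≡ x *z y +z x *z z
  *z-distribˡ-+z = []-elim₃ λ a b c → begin
    [ a ] *z ([ b ] +z [ c ])       ≡⟨ cong ([ a ] *z_) ([+] b c) ⟩
    [ a ] *z [ b + c ]              ≡⟨ [*] a (b + c) ⟩
    [ a * (b + c) ]                 ≡⟨ cong [_] (*-distribˡ-+ a b c) ⟩
    [ a * b + a * c ]               ≡⟨ [+] (a * b) (a * c) ⟨
    [ a * b ] +z [ a * c ]          ≡⟨ cong₂ _+z_ ([*] a b) ([*] a c) ⟨
    [ a ] *z [ b ] +z [ a ] *z [ c ] ∎
    where open ≡-Reasoning

  *z-distribʳ-+z : ∀ x y z → (y +z z) *z x ≡ y *z x +z z *z x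
  *z-distribʳ-+z x y z = begin
    (y +z z) *z x     ≡⟨ *z-comm (y +z z) x ⟩
    x *z (y +z z)     ≡⟨ *z-distribˡ-+z x y z ⟩
    x *z y +z x *z z  ≡⟨ cong₂ _+z_ (*z-comm x y) (*z-comm x z) ⟩
    y *z x +z z *z x  ∎
    where open ≡-Reasoning

  -z-inverseʳ : ∀ x → x +z -z x ≡ 0z
  -z-inverseʳ = []-elim λ a → begin
    [ a ] +z -z [ a ]         ≡⟨ cong ([ a ] +z_) (-[] a) ⟩
    [ a ] +z [ M ∸ a % M ]    ≡⟨ [+] a _ ⟩
    [ a + (M ∸ a % M) ]       ≡⟨ []-%ˡ a _ ⟨
    [ a % M + (M ∸ a % M) ]   ≡⟨ cong [_] (m+[n∸m]≡n (m%n≤n a M)) ⟩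
    [ M ]                     ≡⟨ []-cong (trans (n%n≡0 M) (sym (m<n⇒m%n≡m (m^n>0 2 k)))) ⟩
    0z                        ∎
    where open ≡-Reasoning

  -z-inverseˡ : ∀ x → -z x +z x ≡ 0z
  -z-inverseˡ x = trans (+z-comm (-z x) x) (-z-inverseʳ x)

  isCommutativeRing : IsCommutativeRing _≡_ _+z_ _*z_ -z_ 0z 1z
  isCommutativeRing = record
    { isRing = record
      { +-isAbelianGroup = record
        { isGroup = record
          { isMonoid = record
            { isSemigroup = record
              { isMagma = record { isEquivalence = isEquivalence ; ∙-cong = cong₂ _+z_ }
              ; assoc = +z-assoc }
            ; identity = +z-identityˡ , +z-identityʳ }
          ; inverse = -z-inverseˡ , -z-inverseʳ
          ; ⁻¹-cong = cong -z_ }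
        ; comm = +z-comm }
      ; *-cong = cong₂ _*z_
      ; *-assoc = *z-assoc
      ; *-identity = *z-identityˡ , *z-identityʳ
      ; distrib = *z-distribˡ-+z , *z-distribʳ-+z }
    ; *-comm = *z-comm }

  ring : CommutativeRing _ _
  ring = record { isCommutativeRing = isCommutativeRing }

  open CommutativeRing ring public
    using (+-isCommutativeMonoid)
    renaming (zeroˡ to *z-zeroˡ; zeroʳ to *z-zeroʳ)
  open RingProperties (CommutativeRing.ring ring) public
    using () renaming (-‿distribˡ-* to -z-distribˡ-*z; -‿distribʳ-* to -z-distribʳ-*z)
  open AbelianGroupProperties (CommutativeRing.+-abelianGroup ring) public
    using () renaming (⁻¹-∙-comm to -z-+z-comm; ⁻¹-involutive to -z-involutive; ε⁻¹≈ε to -z-0z; inverseˡ-unique to -z-unique)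

  -- The ring solver needs a coefficient ring with decidable equality whose
  -- arithmetic computes; we use ℤ and its canonical map into Z.
  ⟦_⟧ℤ : ℤ → Z
  ⟦ ℤ.+ n ⟧ℤ = [ n ]
  ⟦ -[1+ n ] ⟧ℤ = -z [ suc n ]

  ⟦-⟧ℤ : ∀ i → ⟦ ℤ.- i ⟧ℤ ≡ -z ⟦ i ⟧ℤ
  ⟦-⟧ℤ (ℤ.+ zero) = sym -z-0z
  ⟦-⟧ℤ (ℤ.+ suc n) = refl
  ⟦-⟧ℤ -[1+ n ] = sym (-z-involutive _)

  ⟦⊖⟧ℤ : ∀ a b → ⟦ a ⊖ b ⟧ℤ ≡ [ a ] +z -z [ b ]
  ⟦⊖⟧ℤ a b with b ≤? a
  ... | yes b≤a = begin
    ⟦ a ⊖ b ⟧ℤ                      ≡⟨ cong ⟦_⟧ℤ (ℤ.⊖-≥ b≤a) ⟩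
    [ a ∸ b ]                       ≡⟨ +z-identityʳ _ ⟨
    [ a ∸ b ] +z 0z                 ≡⟨ cong ([ a ∸ b ] +z_) (-z-inverseʳ [ b ]) ⟨
    [ a ∸ b ] +z ([ b ] +z -z [ b ]) ≡⟨ +z-assoc _ _ _ ⟨
    [ a ∸ b ] +z [ b ] +z -z [ b ]  ≡⟨ cong (_+z -z [ b ]) ([+] (a ∸ b) b) ⟩
    [ a ∸ b + b ] +z -z [ b ]       ≡⟨ cong (λ u → [ u ] +z -z [ b ]) (m∸n+n≡m b≤a) ⟩
    [ a ] +z -z [ b ]               ∎
    where open ≡-Reasoning
  ... | no b≰a = begin
    ⟦ a ⊖ b ⟧ℤ          ≡⟨ cong ⟦_⟧ℤ (ℤ.⊖-< (≰⇒> b≰a)) ⟩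
    ⟦ ℤ.- (ℤ.+ (b ∸ a)) ⟧ℤ ≡⟨ ⟦-⟧ℤ (ℤ.+ (b ∸ a)) ⟩
    -z [ b ∸ a ]        ≡⟨ -z-unique _ _ sum≡0 ⟨
    [ a ] +z -z [ b ]   ∎
    where
    open ≡-Reasoning
    sum≡0 : [ a ] +z -z [ b ] +z [ b ∸ a ] ≡ 0z
    sum≡0 = begin
      [ a ] +z -z [ b ] +z [ b ∸ a ]   ≡⟨ +z-assoc _ _ _ ⟩
      [ a ] +z (-z [ b ] +z [ b ∸ a ]) ≡⟨ cong ([ a ] +z_) (+z-comm (-z [ b ]) [ b ∸ a ]) ⟩
      [ a ] +z ([ b ∸ a ] +z -z [ b ]) ≡⟨ +z-assoc _ _ _ ⟨
      [ a ] +z [ b ∸ a ] +z -z [ b ]   ≡⟨ cong (_+z -z [ b ]) ([+] a (b ∸ a)) ⟩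
      [ a + (b ∸ a) ] +z -z [ b ]      ≡⟨ cong (λ u → [ u ] +z -z [ b ]) (m+[n∸m]≡n (<⇒≤ (≰⇒> b≰a))) ⟩
      [ b ] +z -z [ b ]                ≡⟨ -z-inverseʳ [ b ] ⟩
      0z                               ∎

  ⟦+⟧ℤ : ∀ i j → ⟦ i ℤ.+ j ⟧ℤ ≡ ⟦ i ⟧ℤ +z ⟦ j ⟧ℤ
  ⟦+⟧ℤ (ℤ.+ a) (ℤ.+ b) = sym ([+] a b)
  ⟦+⟧ℤ (ℤ.+ a) -[1+ b ] = ⟦⊖⟧ℤ a (suc b)
  ⟦+⟧ℤ -[1+ a ] (ℤ.+ b) = trans (⟦⊖⟧ℤ b (suc a)) (+z-comm [ b ] (-z [ suc a ]))
  ⟦+⟧ℤ -[1+ a ] -[1+ b ] = begin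
    -z [ suc (suc (a + b)) ]     ≡⟨ cong (λ u → -z [ u ]) (+-suc (suc a) b) ⟨
    -z [ suc a + suc b ]         ≡⟨ cong -z_ ([+] (suc a) (suc b)) ⟨
    -z ([ suc a ] +z [ suc b ])  ≡⟨ -z-+z-comm [ suc a ] [ suc b ] ⟨
    -z [ suc a ] +z -z [ suc b ] ∎
    where open ≡-Reasoning

  ⟦*⟧ℤ⁺ : ∀ a j → ⟦ ℤ.+ a ℤ.* j ⟧ℤ ≡ [ a ] *z ⟦ j ⟧ℤ
  ⟦*⟧ℤ⁺ a (ℤ.+ b) = trans (cong ⟦_⟧ℤ (sym (ℤ.pos-* a b))) (sym ([*] a b))
  ⟦*⟧ℤ⁺ a -[1+ b ] = begin
    ⟦ ℤ.+ a ℤ.* -[1+ b ] ⟧ℤ         ≡⟨ cong ⟦_⟧ℤ (ℤ.neg-distribʳ-* (ℤ.+ a) (ℤ.+ suc b)) ⟨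
    ⟦ ℤ.- (ℤ.+ a ℤ.* ℤ.+ suc b) ⟧ℤ    ≡⟨ ⟦-⟧ℤ (ℤ.+ a ℤ.* ℤ.+ suc b) ⟩
    -z ⟦ ℤ.+ a ℤ.* ℤ.+ suc b ⟧ℤ       ≡⟨ cong -z_ (⟦*⟧ℤ⁺ a (ℤ.+ suc b)) ⟩
    -z ([ a ] *z [ suc b ])       ≡⟨ -z-distribʳ-*z [ a ] [ suc b ] ⟩
    [ a ] *z -z [ suc b ]         ∎
    where open ≡-Reasoning

  ⟦*⟧ℤ : ∀ i j → ⟦ i ℤ.* j ⟧ℤ ≡ ⟦ i ⟧ℤ *z ⟦ j ⟧ℤ
  ⟦*⟧ℤ (ℤ.+ a) j = ⟦*⟧ℤ⁺ a j
  ⟦*⟧ℤ -[1+ a ] j = begin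
    ⟦ -[1+ a ] ℤ.* j ⟧ℤ        ≡⟨ cong ⟦_⟧ℤ (ℤ.neg-distribˡ-* (ℤ.+ suc a) j) ⟨
    ⟦ ℤ.- (ℤ.+ suc a ℤ.* j) ⟧ℤ   ≡⟨ ⟦-⟧ℤ (ℤ.+ suc a ℤ.* j) ⟩
    -z ⟦ ℤ.+ suc a ℤ.* j ⟧ℤ      ≡⟨ cong -z_ (⟦*⟧ℤ⁺ (suc a) j) ⟩
    -z ([ suc a ] *z ⟦ j ⟧ℤ)   ≡⟨ -z-distribˡ-*z [ suc a ] ⟦ j ⟧ℤ ⟩
    -z [ suc a ] *z ⟦ j ⟧ℤ     ∎
    where open ≡-Reasoning

  ℤ-morphism : CommutativeRing.rawRing ℤ.+-*-commutativeRing -Raw-AlmostCommutative⟶ fromCommutativeRing ring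
  ℤ-morphism = record
    { ⟦_⟧ = ⟦_⟧ℤ ; +-homo = ⟦+⟧ℤ ; *-homo = ⟦*⟧ℤ ; -‿homo = ⟦-⟧ℤ ; 0-homo = refl ; 1-homo = refl }

  ⟦⟧ℤ-≟ : ∀ i j → Maybe (⟦ i ⟧ℤ ≡ ⟦ j ⟧ℤ)
  ⟦⟧ℤ-≟ i j with i ℤ.≟ j
  ... | yes i≡j = just (cong ⟦_⟧ℤ i≡j)
  ... | no _ = nothing

  open import Algebra.Solver.Ring _ (fromCommutativeRing ring) ℤ-morphism ⟦⟧ℤ-≟ public
    using (Polynomial; solve; _:=_; _:+_; _:*_; :-_; _:-_; con)

  :0 :1 : ∀ {n} → Polynomial n
  :0 = con (ℤ.+ 0)
  :1 = con (ℤ.+ 1)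
  open import Algebra.Properties.Group (CommutativeRing.+-group ring) public
    using () renaming (∙-cancelˡ to +z-cancelˡ; ∙-cancelʳ to +z-cancelʳ)

  module Z-Sum = ListSum (CommutativeRing.isCommutativeSemiring ring)

  subq≡+z-z : ∀ y x → subq k y x ≡ y +z -z x
  subq≡+z-z y x = begin
    [ toℕ y + (M ∸ toℕ x) ]       ≡⟨ []-%ʳ (toℕ y) _ ⟨
    [ toℕ y + (M ∸ toℕ x) % M ]   ≡⟨ cong (λ u → [ toℕ y + u ]) (toℕ-[] (M ∸ toℕ x)) ⟨
    y +z -z x                     ∎
    where open ≡-Reasoning

module Linear (k : ℕ) where
  open ZMod k
  open Z-Sum

  dot-zeroʳ : ∀ {n} (c : Vec Z n) → dot k c (replicate n 0z) ≡ 0z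
  dot-zeroʳ [] = refl
  dot-zeroʳ (x ∷ c) = trans (cong₂ _+z_ (*z-zeroʳ x) (dot-zeroʳ c)) (+z-identityʳ 0z)

  dot-vaddˡ : ∀ {n} (x y h : Vec Z n) → dot k (vadd k x y) h ≡ dot k x h +z dot k y h
  dot-vaddˡ [] [] [] = sym (+z-identityʳ 0z)
  dot-vaddˡ (a ∷ x) (b ∷ y) (c ∷ h) = trans (cong ((a +z b) *z c +z_) (dot-vaddˡ x y h))
    (solve 5 (λ a b c d e → (a :+ b) :* c :+ (d :+ e) := a :* c :+ d :+ (b :* c :+ e)) refl a b c (dot k x h) (dot k y h))

  dot-vaddʳ : ∀ {n} (c x y : Vec Z n) → dot k c (vadd k x y) ≡ dot k c x +z dot k c y
  dot-vaddʳ [] [] [] = sym (+z-identityʳ 0z)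
  dot-vaddʳ (c ∷ cs) (a ∷ x) (b ∷ y) = trans (cong (c *z (a +z b) +z_) (dot-vaddʳ cs x y))
    (solve 5 (λ a b c d e → c :* (a :+ b) :+ (d :+ e) := c :* a :+ d :+ (c :* b :+ e)) refl a b c (dot k cs x) (dot k cs y))

  dot-vscaleˡ : ∀ {n} (a : Z) (x h : Vec Z n) → dot k (vscale k a x) h ≡ a *z dot k x h
  dot-vscaleˡ a [] [] = sym (*z-zeroʳ a)
  dot-vscaleˡ a (b ∷ x) (c ∷ h) = trans (cong (a *z b *z c +z_) (dot-vscaleˡ a x h))
    (solve 4 (λ a b c d → a :* b :* c :+ a :* d := a :* (b :* c :+ d)) refl a b c (dot k x h))

  dot-vscaleʳ : ∀ {n} (a : Z) (c x : Vec Z n) → dot k c (vscale k a x) ≡ a *z dot k c x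
  dot-vscaleʳ a [] [] = sym (*z-zeroʳ a)
  dot-vscaleʳ a (c ∷ cs) (b ∷ x) = trans (cong (c *z (a *z b) +z_) (dot-vscaleʳ a cs x))
    (solve 4 (λ a b c d → c :* (a :* b) :+ a :* d := a :* (c :* b :+ d)) refl a b c (dot k cs x))

  dot-vecMat : ∀ {R} (cols : List (Vec Z R)) (c : Vec Z R) (h : Vec Z (length cols)) →
    dot k (vecMat k cols c) h ≡ dot k c (matVec k cols h)
  dot-vecMat [] c [] = sym (dot-zeroʳ c)
  dot-vecMat (col ∷ cols) c (h ∷ hs) = begin
    dot k c col *z h +z dot k (vecMat k cols c) hs   ≡⟨ cong₂ _+z_ (*z-comm (dot k c col) h) (dot-vecMat cols c hs) ⟩
    h *z dot k c col +z dot k c (matVec k cols hs)   ≡⟨ cong (_+z dot k c (matVec k cols hs)) (dot-vscaleʳ h c col) ⟨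
    dot k c (vscale k h col) +z dot k c (matVec k cols hs) ≡⟨ dot-vaddʳ c (vscale k h col) (matVec k cols hs) ⟨
    dot k c (matVec k (col ∷ cols) (h ∷ hs))         ∎
    where open ≡-Reasoning

  lookup-vscale : ∀ {n} a (v : Vec Z n) i → Vec.lookup (vscale k a v) i ≡ a *z Vec.lookup v i
  lookup-vscale a (x ∷ v) Fin.zero = refl
  lookup-vscale a (x ∷ v) (Fin.suc i) = lookup-vscale a v i

  lookup-matVec : ∀ {R} (cols : List (Vec Z R)) (H : Vec Z R → Z) (i : Fin R) →
    Vec.lookup (matVec k cols (tabulateOn cols H)) i ≡ ∑ cols (λ col → H col *z Vec.lookup col i)
  lookup-matVec [] H i = Vec.lookup-replicate i 0z
  lookup-matVec (col ∷ cols) H i =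
    trans (Vec.lookup-zipWith (addq k) i (vscale k (H col) col) _)
          (cong₂ _+z_ (lookup-vscale (H col) col i) (lookup-matVec cols H i))

  dot-tabulateOn : ∀ {X : Set} (xs : List X) (F H : X → Z) →
    dot k (tabulateOn xs F) (tabulateOn xs H) ≡ ∑ xs (λ x → F x *z H x)
  dot-tabulateOn [] F H = refl
  dot-tabulateOn (x ∷ xs) F H = cong (F x *z H x +z_) (dot-tabulateOn xs F H)

  vecMat≡tabulateOn : ∀ {R} (cols : List (Vec Z R)) (c : Vec Z R) → vecMat k cols c ≡ tabulateOn cols (dot k c)
  vecMat≡tabulateOn [] c = refl
  vecMat≡tabulateOn (col ∷ cols) c = cong (dot k c col ∷_) (vecMat≡tabulateOn cols c)

module Weight (k : ℕ) where
  open ZMod k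
  open ℕ-Sum

  m : ℕ
  m = 2 ^ (k ∸ 1)

  m>0 : 0 < m
  m>0 = m^n>0 2 (k ∸ 1)

  wt2-zero : ∀ x → toℕ x ≡ 0 → wt2 k x ≡ 0
  wt2-zero x x≡0 with toℕ x ≟ 0
  ... | yes _ = refl
  ... | no x≢0 = ⊥-elim (x≢0 x≡0)

  wt2-half : ∀ x → toℕ x ≡ m → wt2 k x ≡ 2 * m
  wt2-half x x≡m with toℕ x ≟ 0
  ... | yes x≡0 = ⊥-elim (<⇒≢ m>0 (trans (sym x≡0) x≡m))
  ... | no _ with toℕ x ≟ m
  ...   | yes _ = refl
  ...   | no x≢m = ⊥-elim (x≢m x≡m)

  wt2-other : ∀ x → toℕ x ≢ 0 → toℕ x ≢ m → wt2 k x ≡ m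
  wt2-other x x≢0 x≢m with toℕ x ≟ 0
  ... | yes x≡0 = ⊥-elim (x≢0 x≡0)
  ... | no _ with toℕ x ≟ m
  ...   | yes x≡m = ⊥-elim (x≢m x≡m)
  ...   | no _ = refl

  wt2≥m : ∀ x → toℕ x ≢ 0 → m ≤ wt2 k x
  wt2≥m x x≢0 = case (toℕ x ≟ m)
    where
    case : Dec (toℕ x ≡ m) → m ≤ wt2 k x
    case (yes x≡m) = ≤-trans (m≤m+n m (m + 0)) (≤-reflexive (sym (wt2-half x x≡m)))
    case (no x≢m) = ≤-reflexive (sym (wt2-other x x≢0 x≢m))

  wt2≤m : ∀ x → toℕ x ≢ m → wt2 k x ≤ m
  wt2≤m x x≢m = case (toℕ x ≟ 0)
    where
    case : Dec (toℕ x ≡ 0) → wt2 k x ≤ m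
    case (yes x≡0) = ≤-trans (≤-reflexive (wt2-zero x x≡0)) z≤n
    case (no x≢0) = ≤-reflexive (wt2-other x x≢0 x≢m)

  wt2≤2m : ∀ x → wt2 k x ≤ 2 * m
  wt2≤2m x = case (toℕ x ≟ m)
    where
    case : Dec (toℕ x ≡ m) → wt2 k x ≤ 2 * m
    case (yes x≡m) = ≤-reflexive (wt2-half x x≡m)
    case (no x≢m) = ≤-trans (wt2≤m x x≢m) (m≤m+n m (m + 0))

  W : ℕ → ℕ
  W v = wt2 k [ v ]

  W-+M : ∀ v q → W (v + q * M) ≡ W v
  W-+M v q = cong (wt2 k) ([]-cong ([m+kn]%n≡m%n v q M))

  module _ (M≡m+m : M ≡ m + m) where

    private
      toℕ-[]-< : ∀ {a} → a < M → toℕ [ a ] ≡ a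
      toℕ-[]-< a<M = trans (toℕ-[] _) (m<n⇒m%n≡m a<M)

    W-antipodal-< : ∀ r → r < m → W r + W (r + m) ≡ m + m
    W-antipodal-< r r<m with r ≟ 0
    ... | yes refl = cong₂ _+_ (wt2-zero [ 0 ] (toℕ-[]-< (m^n>0 2 k)))
                               (trans (wt2-half [ m ] (toℕ-[]-< m<M)) (cong (m +_) (+-identityʳ m)))
      where
      m<M : m < M
      m<M = subst (m <_) (sym M≡m+m) (m<m+n m m>0)
    ... | no r≢0 = cong₂ _+_ (wt2-other [ r ] (r≢0 ∘ toℕ-r) (<⇒≢ r<m ∘ toℕ-r))
                             (wt2-other [ r + m ] (λ e → <⇒≢ m>0 (sym (m+n≡0⇒n≡0 r (toℕ-r+m e))))
                                                  (λ e → r≢0 (m+n≡n⇒m≡0 (toℕ-r+m e))))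
      where
      r+m<M : r + m < M
      r+m<M = subst (r + m <_) (sym M≡m+m) (+-monoˡ-< m r<m)
      toℕ-r : ∀ {a} → toℕ [ r ] ≡ a → r ≡ a
      toℕ-r = trans (sym (toℕ-[]-< (<-≤-trans r<m (subst (m ≤_) (sym M≡m+m) (m≤m+n m m)))))
      toℕ-r+m : ∀ {a} → toℕ [ r + m ] ≡ a → r + m ≡ a
      toℕ-r+m = trans (sym (toℕ-[]-< r+m<M))
      m+n≡n⇒m≡0 : ∀ {a b} → a + b ≡ b → a ≡ 0
      m+n≡n⇒m≡0 {a} {b} e = +-cancelʳ-≡ b a 0 e

    -- Adding m = M/2 moves a nonzero weight m to itself and swaps 0 with 2m.
    W-antipodal : ∀ v → W v + W (v + m) ≡ m + m
    W-antipodal v = begin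
      W v + W (v + m)                ≡⟨ cong₂ _+_ (cong (wt2 k) ([]-% v)) (cong (wt2 k) ([]-%ˡ v m)) ⟨
      W (v % M) + W (v % M + m)      ≡⟨ reduced (v % M) (m%n<n v M) ⟩
      m + m                          ∎
      where
      open ≡-Reasoning
      reduced : ∀ r → r < M → W r + W (r + m) ≡ m + m
      reduced r r<M with r <? m
      ... | yes r<m = W-antipodal-< r r<m
      ... | no r≮m = begin
        W r + W (r + m)              ≡⟨ cong (λ a → W a + W (a + m)) r≡s+m ⟩
        W (s + m) + W (s + m + m)    ≡⟨ cong (W (s + m) +_) (trans (cong W s+m+m≡s+M) (W-+M s 1)) ⟩
        W (s + m) + W s              ≡⟨ +-comm (W (s + m)) (W s) ⟩
        W s + W (s + m)              ≡⟨ W-antipodal-< s s<m ⟩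
        m + m                        ∎
        where
        s : ℕ
        s = r ∸ m
        r≡s+m : r ≡ s + m
        r≡s+m = sym (m∸n+n≡m (≮⇒≥ r≮m))
        s<m : s < m
        s<m = +-cancelʳ-< m s m (subst₂ _<_ r≡s+m M≡m+m r<M)
        s+m+m≡s+M : s + m + m ≡ s + 1 * M
        s+m+m≡s+M = trans (+-assoc s m m) (cong (s +_) (trans (sym M≡m+m) (sym (*-identityˡ M))))

  -- For odd c the progression splits into antipodal pairs v, v + m; for even c
  -- its two halves coincide with a progression of twice the step.
  ∑W-progression : ∀ j p → p + j ≡ k → ∀ e c → (c * 2 ^ p) % M ≢ 0 →
    ∑ (upTo (2 ^ j)) (λ t → W (e + c * (2 ^ p * t))) ≡ 2 ^ j * m
  ∑W-progression zero p p+0≡k e c c2ᵖ≢0 =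
    ⊥-elim (c2ᵖ≢0 (trans (cong (λ i → (c * 2 ^ i) % M) (trans (sym (+-identityʳ p)) p+0≡k)) (m*n%n≡0 c M)))
  ∑W-progression (suc j) p p+[1+j]≡k e c c2ᵖ≢0 = byParity (parity c)
    where
    open ≡-Reasoning
    P u q : ℕ
    P = 2 ^ j
    u = 2 ^ p
    q = c / 2

    m≡uP : m ≡ u * P
    m≡uP = begin
      2 ^ (k ∸ 1)             ≡⟨ cong (λ i → 2 ^ (i ∸ 1)) (trans (sym p+[1+j]≡k) (+-suc p j)) ⟩
      2 ^ (p + j)             ≡⟨ ^-distribˡ-+-* 2 p j ⟩
      u * P                   ∎

    M≡m+m : M ≡ m + m
    M≡m+m = begin
      2 ^ k                   ≡⟨ cong (2 ^_) (trans (sym p+[1+j]≡k) (+-suc p j)) ⟩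
      2 ^ suc (p + j)         ≡⟨ cong (2 *_) (^-distribˡ-+-* 2 p j) ⟩
      2 * (u * P)             ≡⟨ cong (2 *_) m≡uP ⟨
      2 * m                   ≡⟨ cong (m +_) (+-identityʳ m) ⟩
      m + m                   ∎

    F : ℕ → ℕ
    F t = W (e + c * (u * t))

    halves : ∑ (upTo (2 ^ suc j)) F ≡ ∑ (upTo P) F + ∑ (upTo P) (λ t → F (P + t))
    halves = trans (cong (λ n → ∑ (upTo (P + n)) F) (+-identityʳ P)) (∑-upTo-+ P P F)

    twice : ∀ n → n + n ≡ 2 * n
    twice n = cong (n +_) (sym (+-identityʳ n))

    byParity : c ≡ q * 2 ⊎ c ≡ 1 + q * 2 → ∑ (upTo (2 ^ suc j)) F ≡ 2 ^ suc j * m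
    byParity (inj₂ c≡1+2q) = begin
      ∑ (upTo (2 ^ suc j)) F                                   ≡⟨ halves ⟩
      ∑ (upTo P) F + ∑ (upTo P) (λ t → F (P + t))              ≡⟨ cong (∑ (upTo P) F +_) (∑-cong (upTo P) (λ {t} _ → shift t)) ⟩
      ∑ (upTo P) F + ∑ (upTo P) (λ t → W (e + c * (u * t) + m)) ≡⟨ ∑-⊕ (upTo P) F _ ⟨
      ∑ (upTo P) (λ t → F t + W (e + c * (u * t) + m))         ≡⟨ ∑-cong (upTo P) (λ {t} _ → W-antipodal M≡m+m (e + c * (u * t))) ⟩
      ∑ (upTo P) (λ _ → m + m)                                 ≡⟨ ∑-const (upTo P) (m + m) ⟩
      length (upTo P) * (m + m)                                ≡⟨ cong₂ _*_ (length-upTo P) (twice m) ⟩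
      P * (2 * m)                                              ≡⟨ *-assoc P 2 m ⟨
      P * 2 * m                                                ≡⟨ cong (_* m) (*-comm P 2) ⟩
      2 ^ suc j * m                                            ∎
      where
      shift : ∀ t → F (P + t) ≡ W (e + c * (u * t) + m)
      shift t = trans (cong W (begin
        e + c * (u * (P + t))                              ≡⟨ cong (λ c → e + c * (u * (P + t))) c≡1+2q ⟩
        e + (1 + q * 2) * (u * (P + t))                    ≡⟨ odd-identity e q u P t ⟩
        e + (1 + q * 2) * (u * t) + u * P + q * (2 * (u * P)) ≡⟨ cong₂ (λ c n → e + c * (u * t) + u * P + q * n) (sym c≡1+2q) (sym M≡2uP) ⟩
        e + c * (u * t) + u * P + q * M                    ≡⟨ cong (λ n → e + c * (u * t) + n + q * M) (sym m≡uP) ⟩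
        e + c * (u * t) + m + q * M                        ∎)) (W-+M _ q)
        where
        M≡2uP : M ≡ 2 * (u * P)
        M≡2uP = trans M≡m+m (trans (twice m) (cong (2 *_) m≡uP))
        odd-identity : ∀ e q u P t → e + (1 + q * 2) * (u * (P + t)) ≡ e + (1 + q * 2) * (u * t) + u * P + q * (2 * (u * P))
        odd-identity = solve-∀
    byParity (inj₁ c≡2q) = begin
      ∑ (upTo (2 ^ suc j)) F                          ≡⟨ halves ⟩
      ∑ (upTo P) F + ∑ (upTo P) (λ t → F (P + t))     ≡⟨ cong₂ _+_ (∑-cong (upTo P) (λ {t} _ → lower t)) (∑-cong (upTo P) (λ {t} _ → upper t)) ⟩
      ∑ (upTo P) G + ∑ (upTo P) G                     ≡⟨ cong₂ _+_ G-sum G-sum ⟩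
      P * m + P * m                                   ≡⟨ twice (P * m) ⟩
      2 * (P * m)                                     ≡⟨ *-assoc 2 P m ⟨
      2 ^ suc j * m                                   ∎
      where
      G : ℕ → ℕ
      G t = W (e + q * (2 ^ suc p * t))
      G-sum : ∑ (upTo P) G ≡ P * m
      G-sum = ∑W-progression j (suc p) (trans (sym (+-suc p j)) p+[1+j]≡k) e q
        (λ q2ᵖ⁺¹≡0 → c2ᵖ≢0 (trans (cong (λ c → (c * u) % M) c≡2q) (trans (cong (_% M) (*-assoc q 2 u)) q2ᵖ⁺¹≡0)))
      lower : ∀ t → F t ≡ G t
      lower t = cong W (trans (cong (λ c → e + c * (u * t)) c≡2q) (even-lower e q u t))
        where
        even-lower : ∀ e q u t → e + q * 2 * (u * t) ≡ e + q * (2 * u * t)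
        even-lower = solve-∀
      upper : ∀ t → F (P + t) ≡ G t
      upper t = trans (cong W (begin
        e + c * (u * (P + t))                    ≡⟨ cong (λ c → e + c * (u * (P + t))) c≡2q ⟩
        e + q * 2 * (u * (P + t))                ≡⟨ even-upper e q u P t ⟩
        e + q * (2 * u * t) + q * (u * P + u * P) ≡⟨ cong (λ n → e + q * (2 * u * t) + q * n) (trans M≡m+m (cong₂ _+_ m≡uP m≡uP)) ⟨
        e + q * (2 * u * t) + q * M              ∎)) (W-+M _ q)
        where
        even-upper : ∀ e q u P t → e + q * 2 * (u * (P + t)) ≡ e + q * (2 * u * t) + q * (u * P + u * P)
        even-upper = solve-∀

module Grid (k : ℕ) where
  open ZMod k

  IsLevel : ℕ → Set
  IsLevel j = 1 ≤ j × j ≤ k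

  -- The level-j coordinates of T range over 2^(k-j) Z_{2^k} = { [ u * t ] : t < N }.
  module Level {j : ℕ} (level : IsLevel j) where

    p u N : ℕ
    p = k ∸ j
    u = 2 ^ p
    N = 2 ^ j

    instance
      u≢0 : NonZero u
      u≢0 = m^n≢0 2 p

    a : ℕ → Z
    a t = [ u * t ]

    N*u≡M : N * u ≡ M
    N*u≡M = trans (sym (^-distribˡ-+-* 2 j p)) (cong (2 ^_) (m+[n∸m]≡n (proj₂ level)))

    0<N : 0 < N
    0<N = m^n>0 2 j

    1<N : 1 < N
    1<N = ^-monoʳ-< 2 (s≤s (s≤s z≤n)) (proj₁ level)

    a0≡0z : a 0 ≡ 0z
    a0≡0z = cong [_] (*-zeroʳ u)

    a≡[t]*a1 : ∀ t → a t ≡ [ t ] *z a 1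
    a≡[t]*a1 t = trans (cong [_] (trans (*-comm u t) (cong (t *_) (sym (*-identityʳ u))))) (sym ([*] t (u * 1)))

    a-injective : ∀ {t t′} → t < N → t′ < N → a t ≡ a t′ → t ≡ t′
    a-injective {t} {t′} t<N t′<N at≡at′ = *-cancelˡ-≡ t t′ u ([]-injective-< (bound t<N) (bound t′<N) at≡at′)
      where
      bound : ∀ {t} → t < N → u * t < M
      bound {t} t<N = subst₂ _<_ (*-comm t u) N*u≡M (*-monoˡ-< u t<N)

    [N]*a1≡0z : [ N ] *z a 1 ≡ 0z
    [N]*a1≡0z = begin
      [ N ] *z a 1     ≡⟨ [*] N (u * 1) ⟩
      [ N * (u * 1) ]  ≡⟨ cong (λ v → [ N * v ]) (*-identityʳ u) ⟩
      [ N * u ]        ≡⟨ cong [_] N*u≡M ⟩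
      [ M ]            ≡⟨ []-cong (trans (n%n≡0 M) (sym (m<n⇒m%n≡m (m^n>0 2 k)))) ⟩
      0z               ∎
      where open ≡-Reasoning

    N-torsion : ∀ δ → [ N ] *z δ ≡ 0z → ∃ λ q → q < N × δ ≡ a q
    N-torsion δ Nδ≡0 = q , q<N , δ≡aq
      where
      open ≡-Reasoning
      M∣Nδ : M ∣ N * toℕ δ
      M∣Nδ = m%n≡0⇒n∣m (N * toℕ δ) M (begin
        (N * toℕ δ) % M          ≡⟨ toℕ-[] (N * toℕ δ) ⟨
        toℕ [ N * toℕ δ ]        ≡⟨ cong toℕ ([*] N (toℕ δ)) ⟨
        toℕ ([ N ] *z [ toℕ δ ]) ≡⟨ cong (λ x → toℕ ([ N ] *z x)) ([]-toℕ δ) ⟩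
        toℕ ([ N ] *z δ)         ≡⟨ cong toℕ Nδ≡0 ⟩
        toℕ 0z                   ≡⟨ toℕ-[] 0 ⟩
        0 % M                    ≡⟨ m<n⇒m%n≡m (m^n>0 2 k) ⟩
        0                        ∎)
      u∣δ : u ∣ toℕ δ
      u∣δ = *-cancelˡ-∣ N {{m^n≢0 2 j}} (subst (_∣ N * toℕ δ) (sym N*u≡M) M∣Nδ)
      q = toℕ δ / u
      q<N : q < N
      q<N = m<n*o⇒m/o<n (subst (toℕ δ <_) (sym N*u≡M) (toℕ<n δ))
      δ≡aq : δ ≡ a q
      δ≡aq = trans (sym ([]-toℕ δ)) (cong [_] (sym (m*[n/m]≡n u∣δ)))

  T : (ls : List ℕ) → List (Vec Z (length ls))
  T = tuples k

  step : ℕ → ℕ → Z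
  step j t = [ 2 ^ (k ∸ j) * t ]

  T-∷ : ∀ j ls → T (j ∷ ls) ≡ cartesianCons (2 ^ j) (step j) (T ls)
  T-∷ j ls = trans (concatMap-map≡cartesianProductWith _∷_ (step j) (upTo (2 ^ j)) (T ls))
                   (cong (λ xs → cartesianProductWith _∷_ xs (T ls)) (map-upTo (step j) (2 ^ j)))

  ∈T⁺ : ∀ {j ls t g} → t < 2 ^ j → g ∈ T ls → (step j t ∷ g) ∈ T (j ∷ ls)
  ∈T⁺ {j} {ls} {t} {g} t<N g∈T = subst ((step j t ∷ g) ∈_) (sym (T-∷ j ls)) (∈-cartesianCons⁺ (2 ^ j) (step j) (T ls) t<N g∈T)

  ∈T⁻ : ∀ {j ls v} → v ∈ T (j ∷ ls) → ∃ λ t → ∃ λ g → t < 2 ^ j × g ∈ T ls × v ≡ step j t ∷ g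
  ∈T⁻ {j} {ls} {v} v∈T = ∈-cartesianCons⁻ (2 ^ j) (step j) (T ls) (subst (v ∈_) (T-∷ j ls) v∈T)

  zeros∈T : ∀ ls → replicate (length ls) 0z ∈ T ls
  zeros∈T [] = here refl
  zeros∈T (j ∷ ls) = subst (λ x → (x ∷ replicate (length ls) 0z) ∈ T (j ∷ ls)) (cong [_] (*-zeroʳ (2 ^ (k ∸ j))))
                           (∈T⁺ {j} {ls} {0} (m^n>0 2 j) (zeros∈T ls))

  length-T-∷ : ∀ j ls → length (T (j ∷ ls)) ≡ 2 ^ j * length (T ls)
  length-T-∷ j ls = trans (cong length (T-∷ j ls)) (length-cartesianCons (2 ^ j) (step j) (T ls))

  length-T : ∀ ls → length (T ls) ≡ 2 ^ sum ls
  length-T [] = refl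
  length-T (j ∷ ls) = begin
    length (T (j ∷ ls))     ≡⟨ length-T-∷ j ls ⟩
    2 ^ j * length (T ls)   ≡⟨ cong (2 ^ j *_) (length-T ls) ⟩
    2 ^ j * 2 ^ sum ls      ≡⟨ ^-distribˡ-+-* 2 j (sum ls) ⟨
    2 ^ sum (j ∷ ls)        ∎
    where open ≡-Reasoning

  T-unique : ∀ {ls} → All IsLevel ls → Unique (T ls)
  T-unique [] = [] ∷ []
  T-unique {j ∷ ls} (level ∷ levels) = subst Unique (sym (T-∷ j ls))
    (cartesianCons-unique (2 ^ j) (step j) (T ls) (λ s<t t<N as≡at → <⇒≢ s<t (a-injective (<-trans s<t t<N) t<N as≡at))
                          (T-unique levels))
    where open Level level

  -- a coefficient of a level-j coordinate only matters modulo 2^j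
  canonical : (ls : List ℕ) → List (Vec Z (length ls))
  canonical [] = [] ∷ []
  canonical (j ∷ ls) = cartesianCons (2 ^ j) [_] (canonical ls)

  length-canonical : ∀ ls → length (canonical ls) ≡ 2 ^ sum ls
  length-canonical [] = refl
  length-canonical (j ∷ ls) = begin
    length (canonical (j ∷ ls))     ≡⟨ length-cartesianCons (2 ^ j) [_] (canonical ls) ⟩
    2 ^ j * length (canonical ls)   ≡⟨ cong (2 ^ j *_) (length-canonical ls) ⟩
    2 ^ j * 2 ^ sum ls              ≡⟨ ^-distribˡ-+-* 2 j (sum ls) ⟨
    2 ^ sum (j ∷ ls)                ∎
    where open ≡-Reasoning

  canonical-unique : ∀ {ls} → All IsLevel ls → Unique (canonical ls)
  canonical-unique [] = [] ∷ []
  canonical-unique {j ∷ ls} ((_ , j≤k) ∷ levels) =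
    cartesianCons-unique (2 ^ j) [_] (canonical ls) (λ s<t t<N [s]≡[t] → <⇒≢ s<t ([]-injective-< (bound (<-trans s<t t<N)) (bound t<N) [s]≡[t]))
                         (canonical-unique levels)
    where
    bound : ∀ {t} → t < 2 ^ j → t < M
    bound t<N = <-≤-trans t<N (^-monoʳ-≤ 2 j≤k)

module Affine (k : ℕ) where
  open ZMod k
  open Grid k
  open Z-Sum

  -- formal combinations  ∑ c [g]  of points g
  Combination : ℕ → Set
  Combination n = List (Z × Vec Z n)

  IsAffineRelation : ∀ {n} → Combination n → Set
  IsAffineRelation rel = ∑ rel proj₁ ≡ 0z × (∀ i → ∑ rel (λ (c , g) → c *z Vec.lookup g i) ≡ 0z)

  Annihilates : (ls : List ℕ) → (Vec Z (length ls) → Z) → Set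
  Annihilates ls f = ∀ rel → All (λ (_ , g) → g ∈ T ls) rel → IsAffineRelation rel →
    ∑ rel (λ (c , g) → c *z f g) ≡ 0z

  IsAffineOn : (ls : List ℕ) → (Vec Z (length ls) → Z) → Z → Vec Z (length ls) → Set
  IsAffineOn ls f d cs = ∀ {g} → g ∈ T ls → f g ≡ d +z dot k cs g

  module Step {j ls} (level : IsLevel j) (f : Vec Z (suc (length ls)) → Z) (f-ann : Annihilates (j ∷ ls) f) where
    open Level level

    zs : Vec Z (length ls)
    zs = replicate (length ls) 0z

    a∷∈T : ∀ {t g} → t < N → g ∈ T ls → (a t ∷ g) ∈ T (j ∷ ls)
    a∷∈T {t} = ∈T⁺ {j} {ls} {t}

    zs∈T : zs ∈ T ls
    zs∈T = zeros∈T ls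

    drop-zero-summand : ∀ {x y} e → x ≡ y +z e → e ≡ 0z → x ≡ y
    drop-zero-summand {y = y} e x≡y+e e≡0 = trans x≡y+e (trans (cong (y +z_) e≡0) (+z-identityʳ y))

    restriction-annihilates : Annihilates ls (λ g → f (a 0 ∷ g))
    restriction-annihilates rel on-T (∑c≡0 , ∑cg≡0) =
      trans (sym (∑-map rel lift (λ (c , g) → c *z f g)))
            (f-ann (map lift rel) (All.map⁺ (All.map (a∷∈T 0<N) on-T)) (trans (∑-map rel lift proj₁) ∑c≡0 , coordinates))
      where
      lift : Z × Vec Z (length ls) → Z × Vec Z (suc (length ls))
      lift (c , g) = c , a 0 ∷ g
      coordinates : ∀ i → ∑ (map lift rel) (λ (c , g) → c *z Vec.lookup g i) ≡ 0z
      coordinates Fin.zero = begin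
        ∑ (map lift rel) (λ (c , g) → c *z Vec.lookup g Fin.zero) ≡⟨ ∑-map rel lift _ ⟩
        ∑ rel (λ (c , _) → c *z a 0)                             ≡⟨ ∑-cong rel (λ {(c , _)} _ → *z-comm c (a 0)) ⟩
        ∑ rel (λ (c , _) → a 0 *z c)                             ≡⟨ ∑-⊗ˡ rel (a 0) proj₁ ⟩
        a 0 *z ∑ rel proj₁                                       ≡⟨ cong (a 0 *z_) ∑c≡0 ⟩
        a 0 *z 0z                                                ≡⟨ *z-zeroʳ (a 0) ⟩
        0z                                                       ∎
        where open ≡-Reasoning
      coordinates (Fin.suc i) = trans (∑-map rel lift _) (∑cg≡0 i)

    -- f(a t, g) - f(a t, 0) - f(a 0, g) + f(a 0, 0) is an affine relation
    separable : ∀ {t g} → t < N → g ∈ T ls → f (a t ∷ g) ≡ f (a t ∷ zs) +z f (a 0 ∷ g) +z -z f (a 0 ∷ zs)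
    separable {t} {g} t<N g∈T = drop-zero-summand _
      (solve 4 (λ X B C D → X := B :+ C :- D :+ (:1 :* X :+ (:- :1 :* B :+ (:- :1 :* C :+ (:1 :* D :+ :0))))) refl _ _ _ _)
      (f-ann ((1z , a t ∷ g) ∷ (-z 1z , a t ∷ zs) ∷ (-z 1z , a 0 ∷ g) ∷ (1z , a 0 ∷ zs) ∷ [])
             (a∷∈T t<N g∈T ∷ a∷∈T t<N zs∈T ∷ a∷∈T 0<N g∈T ∷ a∷∈T 0<N zs∈T ∷ [])
             (solve 0 (:1 :+ (:- :1 :+ (:- :1 :+ (:1 :+ :0))) := :0) refl ,
              λ { Fin.zero → solve 2 (λ x y → :1 :* x :+ (:- :1 :* x :+ (:- :1 :* y :+ (:1 :* y :+ :0))) := :0) refl _ _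
                ; (Fin.suc i) → solve 2 (λ x y → :1 :* x :+ (:- :1 :* y :+ (:- :1 :* x :+ (:1 :* y :+ :0))) := :0) refl _ _ }))

    ψ : ℕ → Z
    ψ t = f (a t ∷ zs)

    δ : Z
    δ = ψ 1 +z -z ψ 0

    -- [a t] - t [a 1] + (t - 1) [a 0] is an affine relation
    ψ-linear : ∀ {t} → t < N → ψ t ≡ ψ 0 +z [ t ] *z δ
    ψ-linear {t} t<N = drop-zero-summand _
      (solve 4 (λ X Y Z0 T → X := Z0 :+ T :* (Y :- Z0) :+ (:1 :* X :+ (:- T :* Y :+ ((T :- :1) :* Z0 :+ :0)))) refl (ψ t) (ψ 1) (ψ 0) [ t ])
      (f-ann ((1z , a t ∷ zs) ∷ (-z [ t ] , a 1 ∷ zs) ∷ ([ t ] +z -z 1z , a 0 ∷ zs) ∷ [])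
             (a∷∈T t<N zs∈T ∷ a∷∈T 1<N zs∈T ∷ a∷∈T 0<N zs∈T ∷ [])
             (solve 1 (λ T → :1 :+ (:- T :+ ((T :- :1) :+ :0)) := :0) refl [ t ] ,
              λ { Fin.zero → trans (cong₂ (λ x y → 1z *z x +z (-z [ t ] *z a 1 +z (([ t ] +z -z 1z) *z y +z 0z))) (a≡[t]*a1 t) a0≡0z)
                                   (solve 2 (λ T A → :1 :* (T :* A) :+ (:- T :* A :+ ((T :- :1) :* :0 :+ :0)) := :0) refl [ t ] (a 1))
                ; (Fin.suc i) → solve 2 (λ T y → :1 :* y :+ (:- T :* y :+ ((T :- :1) :* y :+ :0)) := :0) refl [ t ] _ }))

    -- N [a 1] - N [a 0] is an affine relation, since N a 1 = 0
    [N]*δ≡0z : [ N ] *z δ ≡ 0z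
    [N]*δ≡0z = trans
      (solve 3 (λ Nn Y Z0 → Nn :* (Y :- Z0) := Nn :* Y :+ (:- Nn :* Z0 :+ :0)) refl [ N ] (ψ 1) (ψ 0))
      (f-ann (([ N ] , a 1 ∷ zs) ∷ (-z [ N ] , a 0 ∷ zs) ∷ [])
             (a∷∈T 1<N zs∈T ∷ a∷∈T 0<N zs∈T ∷ [])
             (solve 1 (λ Nn → Nn :+ (:- Nn :+ :0) := :0) refl [ N ] ,
              λ { Fin.zero → trans (cong₂ (λ x y → x +z (-z [ N ] *z y +z 0z)) [N]*a1≡0z a0≡0z)
                                   (solve 1 (λ Nn → :0 :+ (:- Nn :* :0 :+ :0) := :0) refl [ N ])
                ; (Fin.suc i) → solve 2 (λ Nn y → Nn :* y :+ (:- Nn :* y :+ :0) := :0) refl [ N ] _ }))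

  annihilating⇒affine : ∀ {ls} → All IsLevel ls → ∀ f → Annihilates ls f →
    ∃ λ d → ∃ λ cs → cs ∈ canonical ls × IsAffineOn ls f d cs
  annihilating⇒affine [] f f-ann = f [] , [] , here refl , λ { (here refl) → sym (+z-identityʳ (f [])) }
  annihilating⇒affine {j ∷ ls} (level ∷ levels) f f-ann =
    extend (annihilating⇒affine levels (λ g → f (a 0 ∷ g)) restriction-annihilates) (N-torsion δ [N]*δ≡0z)
    where
    open Level level
    open Step {j} {ls} level f f-ann
    open ≡-Reasoning
    extend : (∃ λ d → ∃ λ cs → cs ∈ canonical ls × IsAffineOn ls (λ g → f (a 0 ∷ g)) d cs) →
             (∃ λ q → q < N × δ ≡ a q) →
             ∃ λ d → ∃ λ cs → cs ∈ canonical (j ∷ ls) × IsAffineOn (j ∷ ls) f d cs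
    extend (d , cs , cs∈ , affine) (q , q<N , δ≡aq) =
      d , [ q ] ∷ cs , ∈-cartesianCons⁺ N [_] (canonical ls) q<N cs∈ , λ g∈ → on-T (∈T⁻ {j} {ls} g∈)
      where
      on-T : ∀ {v} → (∃ λ t → ∃ λ g → t < N × g ∈ T ls × v ≡ a t ∷ g) → f v ≡ d +z dot k ([ q ] ∷ cs) v
      on-T (t , g , t<N , g∈T , refl) = begin
        f (a t ∷ g)                                      ≡⟨ separable t<N g∈T ⟩
        ψ t +z f (a 0 ∷ g) +z -z ψ 0                     ≡⟨ cong₂ (λ x y → x +z y +z -z ψ 0) (ψ-linear t<N) (affine g∈T) ⟩
        ψ 0 +z [ t ] *z δ +z (d +z dot k cs g) +z -z ψ 0 ≡⟨ solve 4 (λ P0 X D E → P0 :+ X :+ (D :+ E) :- P0 := D :+ (X :+ E)) refl (ψ 0) ([ t ] *z δ) d (dot k cs g) ⟩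
        d +z ([ t ] *z δ +z dot k cs g)                  ≡⟨ cong (λ x → d +z (x +z dot k cs g)) t*δ≡q*at ⟩
        d +z ([ q ] *z a t +z dot k cs g)                ∎
        where
        t*δ≡q*at : [ t ] *z δ ≡ [ q ] *z a t
        t*δ≡q*at = begin
          [ t ] *z δ         ≡⟨ cong ([ t ] *z_) δ≡aq ⟩
          [ t ] *z [ u * q ] ≡⟨ [*] t (u * q) ⟩
          [ t * (u * q) ]    ≡⟨ cong [_] (*-comm t (u * q)) ⟩
          [ u * q * t ]      ≡⟨ cong (λ n → [ n * t ]) (*-comm u q) ⟩
          [ q * u * t ]      ≡⟨ cong [_] (*-assoc q u t) ⟩
          [ q * (u * t) ]    ≡⟨ [*] q (u * t) ⟨
          [ q ] *z a t       ∎

  affine-unique : ∀ {ls} → All IsLevel ls → ∀ {d d′ cs cs′} → cs ∈ canonical ls → cs′ ∈ canonical ls →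
    (∀ {g} → g ∈ T ls → d +z dot k cs g ≡ d′ +z dot k cs′ g) → d ≡ d′ × cs ≡ cs′
  affine-unique [] (here refl) (here refl) same = trans (sym (+z-identityʳ _)) (trans (same (here refl)) (+z-identityʳ _)) , refl
  affine-unique {j ∷ ls} (level ∷ levels) {d} {d′} cs∈ cs′∈ =
    split (∈-cartesianCons⁻ (2 ^ j) [_] (canonical ls) cs∈) (∈-cartesianCons⁻ (2 ^ j) [_] (canonical ls) cs′∈)
    where
    open Level level
    open Linear k using (dot-zeroʳ)
    open ≡-Reasoning
    zs : Vec Z (length ls)
    zs = replicate (length ls) 0z

    drop-a0 : ∀ s x → [ s ] *z a 0 +z x ≡ x
    drop-a0 s x = trans (cong (λ y → [ s ] *z y +z x) a0≡0z) (trans (cong (_+z x) (*z-zeroʳ [ s ])) (+z-identityˡ x))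

    at-a1 : ∀ s e → [ s ] *z a 1 +z dot k e zs ≡ [ s ] *z a 1
    at-a1 s e = trans (cong ([ s ] *z a 1 +z_) (dot-zeroʳ e)) (+z-identityʳ _)

    split : ∀ {cs cs′} → (∃ λ t → ∃ λ c → t < N × c ∈ canonical ls × cs ≡ [ t ] ∷ c) →
                         (∃ λ t → ∃ λ c → t < N × c ∈ canonical ls × cs′ ≡ [ t ] ∷ c) →
            (∀ {g} → g ∈ T (j ∷ ls) → d +z dot k cs g ≡ d′ +z dot k cs′ g) → d ≡ d′ × cs ≡ cs′
    split (t , c , t<N , c∈ , refl) (t′ , c′ , t′<N , c′∈ , refl) same =
      d≡d′ , cong₂ _∷_ (cong [_] t≡t′) c≡c′
      where
      same-at-0 : ∀ {g} → g ∈ T ls → d +z dot k c g ≡ d′ +z dot k c′ g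
      same-at-0 {g} g∈T = begin
        d +z dot k c g                      ≡⟨ cong (d +z_) (drop-a0 t _) ⟨
        d +z ([ t ] *z a 0 +z dot k c g)    ≡⟨ same (∈T⁺ {j} {ls} {0} 0<N g∈T) ⟩
        d′ +z ([ t′ ] *z a 0 +z dot k c′ g) ≡⟨ cong (d′ +z_) (drop-a0 t′ _) ⟩
        d′ +z dot k c′ g                    ∎
      d≡d′ : d ≡ d′
      d≡d′ = proj₁ (affine-unique levels c∈ c′∈ same-at-0)
      c≡c′ : c ≡ c′
      c≡c′ = proj₂ (affine-unique levels c∈ c′∈ same-at-0)
      [t]*a1≡[t′]*a1 : [ t ] *z a 1 ≡ [ t′ ] *z a 1
      [t]*a1≡[t′]*a1 = +z-cancelˡ d _ _ (begin
        d +z [ t ] *z a 1                    ≡⟨ cong (d +z_) (at-a1 t c) ⟨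
        d +z ([ t ] *z a 1 +z dot k c zs)    ≡⟨ same (∈T⁺ {j} {ls} {1} 1<N (zeros∈T ls)) ⟩
        d′ +z ([ t′ ] *z a 1 +z dot k c′ zs) ≡⟨ cong₂ _+z_ (sym d≡d′) (at-a1 t′ c′) ⟩
        d +z [ t′ ] *z a 1                   ∎)
      t≡t′ : t ≡ t′
      t≡t′ = a-injective t<N t′<N (trans (a≡[t]*a1 t) (trans [t]*a1≡[t′]*a1 (sym (a≡[t]*a1 t′))))

module Balance (k : ℕ) where
  open ZMod k
  open Grid k
  open Weight k
  open ℕ-Sum

  ∑-T-∷ : ∀ j ls (F : Vec Z (suc (length ls)) → ℕ) →
    ∑ (T (j ∷ ls)) F ≡ ∑ (upTo (2 ^ j)) (λ t → ∑ (T ls) (λ g → F (step j t ∷ g)))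
  ∑-T-∷ j ls F = trans (cong (λ xs → ∑ xs F) (T-∷ j ls)) (∑-cartesianCons (2 ^ j) (step j) (T ls) F)

  -- Unless cs·g vanishes on T, some coordinate moves it along a progression with
  -- nonzero step, over which the weights average to m (∑W-progression).
  vanishes-or-balanced : ∀ {ls} → All IsLevel ls → ∀ cs →
    (∀ {g} → g ∈ T ls → dot k cs g ≡ 0z) ⊎ (∀ e → ∑ (T ls) (λ g → wt2 k (e +z dot k cs g)) ≡ length (T ls) * m)
  vanishes-or-balanced [] [] = inj₁ λ { (here refl) → refl }
  vanishes-or-balanced {j ∷ ls} (level ∷ levels) (c ∷ cs) = extend (vanishes-or-balanced levels cs)
    where
    open Level level
    open ≡-Reasoning
    n : ℕ
    n = length (T ls)

    total : ∀ e (G : ℕ → ℕ) → (∀ t → ∑ (T ls) (λ g → wt2 k (e +z dot k (c ∷ cs) (a t ∷ g))) ≡ G t) →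
      ∑ (T (j ∷ ls)) (λ g → wt2 k (e +z dot k (c ∷ cs) g)) ≡ ∑ (upTo N) G
    total e G inner = trans (∑-T-∷ j ls _) (∑-cong (upTo N) (λ {t} _ → inner t))

    extend : (∀ {g} → g ∈ T ls → dot k cs g ≡ 0z) ⊎ (∀ e → ∑ (T ls) (λ g → wt2 k (e +z dot k cs g)) ≡ n * m) →
      (∀ {g} → g ∈ T (j ∷ ls) → dot k (c ∷ cs) g ≡ 0z) ⊎ (∀ e → ∑ (T (j ∷ ls)) (λ g → wt2 k (e +z dot k (c ∷ cs) g)) ≡ length (T (j ∷ ls)) * m)
    extend (inj₂ balanced) = inj₂ λ e → begin
      ∑ (T (j ∷ ls)) (λ g → wt2 k (e +z dot k (c ∷ cs) g)) ≡⟨ total e (λ _ → n * m) (λ t →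
          trans (∑-cong (T ls) (λ {g} _ → cong (wt2 k) (sym (+z-assoc e (c *z a t) (dot k cs g))))) (balanced (e +z c *z a t))) ⟩
      ∑ (upTo N) (λ _ → n * m)                              ≡⟨ ∑-const (upTo N) (n * m) ⟩
      length (upTo N) * (n * m)                             ≡⟨ cong (_* (n * m)) (length-upTo N) ⟩
      N * (n * m)                                           ≡⟨ *-assoc N n m ⟨
      N * n * m                                             ≡⟨ cong (_* m) (length-T-∷ j ls) ⟨
      length (T (j ∷ ls)) * m                               ∎
    extend (inj₁ vanishes) with c *z a 1 Fin.≟ 0z
    ... | yes c*a1≡0 = inj₁ λ g∈ → vanishes-at (∈T⁻ {j} {ls} g∈)
      where
      vanishes-at : ∀ {v} → (∃ λ t → ∃ λ g → t < N × g ∈ T ls × v ≡ a t ∷ g) → dot k (c ∷ cs) v ≡ 0z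
      vanishes-at (t , g , _ , g∈T , refl) = begin
        c *z a t +z dot k cs g         ≡⟨ cong₂ (λ x y → c *z x +z y) (a≡[t]*a1 t) (vanishes g∈T) ⟩
        c *z ([ t ] *z a 1) +z 0z      ≡⟨ solve 3 (λ c T A → c :* (T :* A) :+ :0 := T :* (c :* A)) refl c [ t ] (a 1) ⟩
        [ t ] *z (c *z a 1)            ≡⟨ cong ([ t ] *z_) c*a1≡0 ⟩
        [ t ] *z 0z                    ≡⟨ *z-zeroʳ [ t ] ⟩
        0z                             ∎
    ... | no c*a1≢0 = inj₂ λ e → begin
      ∑ (T (j ∷ ls)) (λ g → wt2 k (e +z dot k (c ∷ cs) g))   ≡⟨ total e (λ t → n * W (toℕ e + toℕ c * (u * t))) (λ t →
          trans (∑-cong (T ls) (λ {g} g∈T → cong (λ x → wt2 k (e +z (c *z a t +z x))) (vanishes g∈T)))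
                (trans (∑-const (T ls) _) (cong (n *_) (on-line e t)))) ⟩
      ∑ (upTo N) (λ t → n * W (toℕ e + toℕ c * (u * t)))    ≡⟨ ∑-⊗ˡ (upTo N) n _ ⟩
      n * ∑ (upTo N) (λ t → W (toℕ e + toℕ c * (u * t)))    ≡⟨ cong (n *_) (∑W-progression j p (m∸n+n≡m (proj₂ level)) (toℕ e) (toℕ c) c*u≢0) ⟩
      n * (N * m)                                           ≡⟨ *-assoc n N m ⟨
      n * N * m                                             ≡⟨ cong (_* m) (trans (*-comm n N) (sym (length-T-∷ j ls))) ⟩
      length (T (j ∷ ls)) * m                               ∎
      where
      on-line : ∀ e t → wt2 k (e +z (c *z a t +z 0z)) ≡ W (toℕ e + toℕ c * (u * t))
      on-line e t = cong (wt2 k) (begin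
        e +z (c *z a t +z 0z)                   ≡⟨ cong (e +z_) (+z-identityʳ (c *z a t)) ⟩
        e +z c *z a t                           ≡⟨ cong₂ (λ x y → x +z y *z a t) ([]-toℕ e) ([]-toℕ c) ⟨
        [ toℕ e ] +z [ toℕ c ] *z [ u * t ]     ≡⟨ cong ([ toℕ e ] +z_) ([*] (toℕ c) (u * t)) ⟩
        [ toℕ e ] +z [ toℕ c * (u * t) ]        ≡⟨ [+] (toℕ e) _ ⟩
        [ toℕ e + toℕ c * (u * t) ]             ∎)
      c*u≢0 : (toℕ c * u) % M ≢ 0
      c*u≢0 c*u≡0 = c*a1≢0 (begin
        c *z a 1                       ≡⟨ cong (_*z a 1) ([]-toℕ c) ⟨
        [ toℕ c ] *z [ u * 1 ]         ≡⟨ [*] (toℕ c) (u * 1) ⟩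
        [ toℕ c * (u * 1) ]            ≡⟨ cong (λ n → [ toℕ c * n ]) (*-identityʳ u) ⟩
        [ toℕ c * u ]                  ≡⟨ []-cong (trans c*u≡0 (sym (m<n⇒m%n≡m (m^n>0 2 k)))) ⟩
        0z                             ∎)

module Generator (k : ℕ) {ls : List ℕ} (levels : All (Grid.IsLevel k) ls) where
  open ZMod k
  open Linear k
  open Grid k
  open Affine k
  open Z-Sum

  R : ℕ
  R = suc (length ls)

  columns : List (Vec Z R)
  columns = map (1z ∷_) (T ls)

  Dual : Vec Z (length columns) → Set
  Dual x = ∀ h → matVec k columns h ≡ replicate R 0z → dot k x h ≡ 0z

  columns-unique : Unique columns
  columns-unique = Unique-map⁺-injectiveOn (1z ∷_) (T-unique levels) (λ _ _ → Vec.∷-injectiveʳ)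

  rowSpace⊆Dual : ∀ c → Dual (vecMat k columns c)
  rowSpace⊆Dual c h Bh≡0 = trans (dot-vecMat columns c h) (trans (cong (dot k c) Bh≡0) (dot-zeroʳ c))

  Dual-vadd : ∀ x y → Dual x → Dual y → Dual (vadd k x y)
  Dual-vadd x y x⊥ y⊥ h Bh≡0 = trans (dot-vaddˡ x y h) (trans (cong₂ _+z_ (x⊥ h Bh≡0) (y⊥ h Bh≡0)) (+z-identityʳ 0z))

  Dual-vscale : ∀ a x → Dual x → Dual (vscale k a x)
  Dual-vscale a x x⊥ h Bh≡0 = trans (dot-vscaleˡ a x h) (trans (cong (a *z_) (x⊥ h Bh≡0)) (*z-zeroʳ a))

  _≟V_ : DecidableEquality (Vec Z R)
  _≟V_ = Vec.≡-dec Fin._≟_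

  -- x as a function of the column it sits in
  entry : Vec Z (length columns) → Vec Z R → Z
  entry = entryAt _≟V_ 0z columns

  -- an affine relation among points of T, read as a vector h with B_I h = 0
  relationVector : Combination (length ls) → Vec Z R → Z
  relationVector rel col = ∑ rel (λ (c , g) → c *z indicator _≟V_ (1z ∷ g) col)

  ∑-relationVector : ∀ rel (G : Vec Z R → Z) → All (λ (_ , g) → g ∈ T ls) rel →
    ∑ columns (λ col → relationVector rel col *z G col) ≡ ∑ rel (λ (c , g) → c *z G (1z ∷ g))
  ∑-relationVector [] G [] = ∑-zero columns (λ {col} _ → *z-zeroˡ (G col))
  ∑-relationVector ((c , v) ∷ rel) G (v∈T ∷ on-T) = begin
    ∑ columns (λ col → (c *z ind col +z relationVector rel col) *z G col)
      ≡⟨ ∑-cong columns (λ {col} _ → trans (*z-distribʳ-+z (G col) (c *z ind col) _) (cong (_+z _) (*z-assoc c (ind col) (G col)))) ⟩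
    ∑ columns (λ col → c *z (ind col *z G col) +z relationVector rel col *z G col)
      ≡⟨ ∑-⊕ columns _ _ ⟩
    ∑ columns (λ col → c *z (ind col *z G col)) +z ∑ columns (λ col → relationVector rel col *z G col)
      ≡⟨ cong₂ _+z_ (trans (∑-⊗ˡ columns c _) (cong (c *z_) (∑-indicator _≟V_ (1z ∷ v) G columns-unique (∈-map⁺ (1z ∷_) v∈T))))
                    (∑-relationVector rel G on-T) ⟩
    c *z G (1z ∷ v) +z ∑ rel (λ (c , g) → c *z G (1z ∷ g)) ∎
    where
    open ≡-Reasoning
    ind : Vec Z R → Z
    ind = indicator _≟V_ (1z ∷ v)

  relationVector-kernel : ∀ rel → All (λ (_ , g) → g ∈ T ls) rel → IsAffineRelation rel →
    matVec k columns (tabulateOn columns (relationVector rel)) ≡ replicate R 0z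
  relationVector-kernel rel on-T (∑c≡0 , ∑cg≡0) = lookup-ext _ _ λ i → trans (coordinate i) (sym (Vec.lookup-replicate i 0z))
    where
    coordinate : ∀ i → Vec.lookup (matVec k columns (tabulateOn columns (relationVector rel))) i ≡ 0z
    coordinate i = trans (lookup-matVec columns (relationVector rel) i) (trans (∑-relationVector rel (λ col → Vec.lookup col i) on-T) (by-row i))
      where
      by-row : ∀ i → ∑ rel (λ (c , g) → c *z Vec.lookup (1z ∷ g) i) ≡ 0z
      by-row Fin.zero = trans (∑-cong rel (λ {(c , _)} _ → *z-identityʳ c)) ∑c≡0
      by-row (Fin.suc i) = ∑cg≡0 i

  Dual⇒annihilates : ∀ x → Dual x → Annihilates ls (λ g → entry x (1z ∷ g))
  Dual⇒annihilates x x⊥ rel on-T affine = begin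
    ∑ rel (λ (c , g) → c *z entry x (1z ∷ g))                               ≡⟨ ∑-relationVector rel (entry x) on-T ⟨
    ∑ columns (λ col → relationVector rel col *z entry x col)               ≡⟨ ∑-cong columns (λ {col} _ → *z-comm _ (entry x col)) ⟩
    ∑ columns (λ col → entry x col *z relationVector rel col)               ≡⟨ dot-tabulateOn columns (entry x) (relationVector rel) ⟨
    dot k (tabulateOn columns (entry x)) (tabulateOn columns (relationVector rel)) ≡⟨ cong (λ y → dot k y _) (tabulateOn-entryAt _≟V_ 0z x columns-unique) ⟩
    dot k x (tabulateOn columns (relationVector rel))                       ≡⟨ x⊥ _ (relationVector-kernel rel on-T affine) ⟩
    0z                                                                      ∎
    where open ≡-Reasoning

  Dual⇒rowSpace : ∀ x → Dual x → ∃ λ d → ∃ λ cs → cs ∈ canonical ls × x ≡ vecMat k columns (d ∷ cs)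
  Dual⇒rowSpace x x⊥ = rowSpace (annihilating⇒affine levels _ (Dual⇒annihilates x x⊥))
    where
    open ≡-Reasoning
    rowSpace : (∃ λ d → ∃ λ cs → cs ∈ canonical ls × IsAffineOn ls (λ g → entry x (1z ∷ g)) d cs) →
               ∃ λ d → ∃ λ cs → cs ∈ canonical ls × x ≡ vecMat k columns (d ∷ cs)
    rowSpace (d , cs , cs∈ , affine) = d , cs , cs∈ , (begin
      x                                         ≡⟨ tabulateOn-entryAt _≟V_ 0z x columns-unique ⟨
      tabulateOn columns (entry x)              ≡⟨ tabulateOn-cong columns (∈-map-elim (λ col → entry x col ≡ dot k (d ∷ cs) col) on-T) ⟩
      tabulateOn columns (dot k (d ∷ cs))       ≡⟨ vecMat≡tabulateOn columns (d ∷ cs) ⟨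
      vecMat k columns (d ∷ cs)                 ∎)
      where
      on-T : ∀ {g} → g ∈ T ls → entry x (1z ∷ g) ≡ d *z 1z +z dot k cs g
      on-T {g} g∈T = trans (affine g∈T) (cong (_+z dot k cs g) (sym (*z-identityʳ d)))

  messages : List (Vec Z R)
  messages = cartesianProductWith _∷_ (allFin M) (canonical ls)

  codewords : List (Vec Z (length columns))
  codewords = map (vecMat k columns) messages

  vecMat-injective : ∀ {d d′ cs cs′} → cs ∈ canonical ls → cs′ ∈ canonical ls →
    vecMat k columns (d ∷ cs) ≡ vecMat k columns (d′ ∷ cs′) → d ∷ cs ≡ d′ ∷ cs′
  vecMat-injective {d} {d′} {cs} {cs′} cs∈ cs′∈ same = uncurry (cong₂ _∷_) (affine-unique levels cs∈ cs′∈ same-on-T)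
    where
    same-on-T : ∀ {g} → g ∈ T ls → d +z dot k cs g ≡ d′ +z dot k cs′ g
    same-on-T g∈T = trans (cong (_+z _) (sym (*z-identityʳ d)))
      (trans (tabulateOn-injective columns
               (trans (sym (vecMat≡tabulateOn columns (d ∷ cs))) (trans same (vecMat≡tabulateOn columns (d′ ∷ cs′))))
               (∈-map⁺ (1z ∷_) g∈T))
             (cong (_+z _) (*z-identityʳ d′)))

  codewords-unique : Unique codewords
  codewords-unique = Unique-map⁺-injectiveOn (vecMat k columns)
    (Unique.cartesianProductWith⁺ _∷_ Vec.∷-injective (Unique.allFin⁺ M) (canonical-unique levels))
    injective
    where
    injective : ∀ {c c′} → c ∈ messages → c′ ∈ messages → vecMat k columns c ≡ vecMat k columns c′ → c ≡ c′
    injective c∈ c′∈ = split (∈-cartesianProductWith⁻ _∷_ (allFin M) (canonical ls) c∈)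
                             (∈-cartesianProductWith⁻ _∷_ (allFin M) (canonical ls) c′∈)
      where
      split : ∀ {c c′} → (∃ λ d → ∃ λ cs → d ∈ allFin M × cs ∈ canonical ls × c ≡ d ∷ cs) →
                         (∃ λ d → ∃ λ cs → d ∈ allFin M × cs ∈ canonical ls × c′ ≡ d ∷ cs) →
              vecMat k columns c ≡ vecMat k columns c′ → c ≡ c′
      split (_ , _ , _ , cs∈ , refl) (_ , _ , _ , cs′∈ , refl) = vecMat-injective cs∈ cs′∈

  codeword⇒Dual : ∀ {x} → x ∈ codewords → Dual x
  codeword⇒Dual = ∈-map-elim Dual (λ {c} _ → rowSpace⊆Dual c)

  Dual⇒codeword : ∀ {x} → Dual x → x ∈ codewords
  Dual⇒codeword {x} x⊥ =
    let d , cs , cs∈ , x≡ = Dual⇒rowSpace x x⊥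
    in subst (_∈ codewords) (sym x≡) (∈-map⁺ (vecMat k columns) (∈-cartesianProductWith⁺ _∷_ (∈-allFin d) cs∈))

  length-codewords : length codewords ≡ M * 2 ^ sum ls
  length-codewords = begin
    length codewords                           ≡⟨ length-map (vecMat k columns) messages ⟩
    length messages                            ≡⟨ length-cartesianProductWith _∷_ (allFin M) (canonical ls) ⟩
    length (allFin M) * length (canonical ls) ≡⟨ cong₂ _*_ (length-tabulate {n = M} id) (length-canonical ls) ⟩
    M * 2 ^ sum ls                             ∎
    where open ≡-Reasoning

module Distance (k : ℕ) {ls : List ℕ} (levels : All (Grid.IsLevel k) ls) where
  open ZMod k
  open Linear k
  open Grid k
  open Weight k
  open Balance k
  open Generator k levels using (columns; Dual; Dual⇒rowSpace)
  open ℕ-Sum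

  dist2-tabulateOn : ∀ {X : Set} (xs : List X) (F G : X → Z) →
    dist2 k (tabulateOn xs F) (tabulateOn xs G) ≡ ∑ xs (λ x → wt2 k (subq k (G x) (F x)))
  dist2-tabulateOn [] F G = refl
  dist2-tabulateOn (x ∷ xs) F G = cong (wt2 k (subq k (G x) (F x)) +_) (dist2-tabulateOn xs F G)

  module _ (dX dY : Z) (csX csY : Vec Z (length ls)) where

    Δcs : Vec Z (length ls)
    Δcs = vadd k csY (vscale k (-z 1z) csX)

    difference : ∀ g → subq k (dot k (dY ∷ csY) (1z ∷ g)) (dot k (dX ∷ csX) (1z ∷ g)) ≡ (dY +z -z dX) +z dot k Δcs g
    difference g = begin
      subq k (dot k (dY ∷ csY) (1z ∷ g)) (dot k (dX ∷ csX) (1z ∷ g))        ≡⟨ subq≡+z-z (dot k (dY ∷ csY) (1z ∷ g)) (dot k (dX ∷ csX) (1z ∷ g)) ⟩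
      dY *z 1z +z dot k csY g +z -z (dX *z 1z +z dot k csX g)               ≡⟨ solve 4 (λ a b c d → a :* :1 :+ b :- (c :* :1 :+ d)
                                                                                   := a :- c :+ (b :+ (:- :1) :* d)) refl dY (dot k csY g) dX (dot k csX g) ⟩
      (dY +z -z dX) +z (dot k csY g +z (-z 1z) *z dot k csX g)             ≡⟨ cong ((dY +z -z dX) +z_) (cong (dot k csY g +z_) (dot-vscaleˡ (-z 1z) csX g)) ⟨
      (dY +z -z dX) +z (dot k csY g +z dot k (vscale k (-z 1z) csX) g)      ≡⟨ cong ((dY +z -z dX) +z_) (dot-vaddˡ csY _ g) ⟨
      (dY +z -z dX) +z dot k Δcs g                                         ∎
      where open ≡-Reasoning

    dist2-codewords : dist2 k (vecMat k columns (dX ∷ csX)) (vecMat k columns (dY ∷ csY)) ≡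
      ∑ (T ls) (λ g → wt2 k ((dY +z -z dX) +z dot k Δcs g))
    dist2-codewords = begin
      dist2 k (vecMat k columns (dX ∷ csX)) (vecMat k columns (dY ∷ csY))
        ≡⟨ cong₂ (dist2 k) (vecMat≡tabulateOn columns (dX ∷ csX)) (vecMat≡tabulateOn columns (dY ∷ csY)) ⟩
      dist2 k (tabulateOn columns (dot k (dX ∷ csX))) (tabulateOn columns (dot k (dY ∷ csY)))
        ≡⟨ dist2-tabulateOn columns _ _ ⟩
      ∑ columns (λ col → wt2 k (subq k (dot k (dY ∷ csY) col) (dot k (dX ∷ csX) col)))
        ≡⟨ ∑-map (T ls) (1z ∷_) _ ⟩
      ∑ (T ls) (λ g → wt2 k (subq k (dot k (dY ∷ csY) (1z ∷ g)) (dot k (dX ∷ csX) (1z ∷ g))))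
        ≡⟨ ∑-cong (T ls) (λ {g} _ → cong (wt2 k) (difference g)) ⟩
      ∑ (T ls) (λ g → wt2 k ((dY +z -z dX) +z dot k Δcs g)) ∎
      where open ≡-Reasoning

    equal-codewords : dY +z -z dX ≡ 0z → (∀ {g} → g ∈ T ls → dot k Δcs g ≡ 0z) →
      vecMat k columns (dX ∷ csX) ≡ vecMat k columns (dY ∷ csY)
    equal-codewords Δd≡0 Δcs≡0 = begin
      vecMat k columns (dX ∷ csX)          ≡⟨ vecMat≡tabulateOn columns (dX ∷ csX) ⟩
      tabulateOn columns (dot k (dX ∷ csX)) ≡⟨ tabulateOn-cong columns on-columns ⟩
      tabulateOn columns (dot k (dY ∷ csY)) ≡⟨ vecMat≡tabulateOn columns (dY ∷ csY) ⟨
      vecMat k columns (dY ∷ csY)          ∎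
      where
      open ≡-Reasoning
      on-columns : ∀ {col} → col ∈ columns → dot k (dX ∷ csX) col ≡ dot k (dY ∷ csY) col
      on-columns = ∈-map-elim (λ col → dot k (dX ∷ csX) col ≡ dot k (dY ∷ csY) col) on-T
        where
        on-T : ∀ {g} → g ∈ T ls → dot k (dX ∷ csX) (1z ∷ g) ≡ dot k (dY ∷ csY) (1z ∷ g)
        on-T {g} g∈T = +z-cancelʳ (-z dot k (dX ∷ csX) (1z ∷ g)) _ _ (begin
            dot k (dX ∷ csX) (1z ∷ g) +z -z dot k (dX ∷ csX) (1z ∷ g)   ≡⟨ -z-inverseʳ _ ⟩
            0z                                                          ≡⟨ +z-identityʳ 0z ⟨
            0z +z 0z                                                    ≡⟨ cong₂ _+z_ Δd≡0 (Δcs≡0 g∈T) ⟨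
            (dY +z -z dX) +z dot k Δcs g                                ≡⟨ difference g ⟨
            subq k (dot k (dY ∷ csY) (1z ∷ g)) (dot k (dX ∷ csX) (1z ∷ g)) ≡⟨ subq≡+z-z (dot k (dY ∷ csY) (1z ∷ g)) (dot k (dX ∷ csX) (1z ∷ g)) ⟩
            dot k (dY ∷ csY) (1z ∷ g) +z -z dot k (dX ∷ csX) (1z ∷ g)   ∎)

  -- a constant nonzero difference has weight ≥ m everywhere; otherwise use balance
  weight≥ : ∀ e cs → (e ≡ 0z → (∀ {g} → g ∈ T ls → dot k cs g ≡ 0z) → ⊥) →
    length (T ls) * m ≤ ∑ (T ls) (λ g → wt2 k (e +z dot k cs g))
  weight≥ e cs nonzero with vanishes-or-balanced levels cs
  ... | inj₂ balanced = ≤-reflexive (sym (balanced e))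
  ... | inj₁ vanishes with toℕ e ≟ 0
  ...   | yes e≡0 = ⊥-elim (nonzero (trans (sym ([]-toℕ e)) (cong [_] e≡0)) vanishes)
  ...   | no e≢0 = subst (length (T ls) * m ≤_)
            (sym (trans (∑-cong (T ls) (λ g∈T → cong (λ x → wt2 k (e +z x)) (vanishes g∈T)))
                 (trans (∑-cong (T ls) (λ _ → cong (wt2 k) (+z-identityʳ e))) (∑-const (T ls) (wt2 k e)))))
            (*-monoʳ-≤ (length (T ls)) (wt2≥m e e≢0))

  minimum-distance : ∀ {x y} → Dual x → Dual y → x ≢ y → length (T ls) * m ≤ dist2 k x y
  minimum-distance {x} {y} x⊥ y⊥ x≢y =
    let dX , csX , _ , x≡ = Dual⇒rowSpace x x⊥
        dY , csY , _ , y≡ = Dual⇒rowSpace y y⊥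
    in subst₂ (λ x y → length (T ls) * m ≤ dist2 k x y) (sym x≡) (sym y≡)
         (subst (length (T ls) * m ≤_) (sym (dist2-codewords dX dY csX csY))
           (weight≥ (dY +z -z dX) (Δcs dX dY csX csY) (λ Δd≡0 Δcs≡0 → x≢y (trans x≡ (trans (equal-codewords dX dY csX csY Δd≡0 Δcs≡0) (sym y≡))))))


hamming-++ : ∀ {a b} (u w : Vec Bool a) (u′ w′ : Vec Bool b) →
  hamming (u Vec.++ u′) (w Vec.++ w′) ≡ hamming u w + hamming u′ w′
hamming-++ [] [] u′ w′ = refl
hamming-++ (x ∷ u) (y ∷ w) u′ w′ =
  trans (cong ((if x xor y then 1 else 0) +_) (hamming-++ u w u′ w′)) (sym (+-assoc (if x xor y then 1 else 0) _ _))

hamming-self : ∀ {a} (u : Vec Bool a) → hamming u u ≡ 0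
hamming-self [] = refl
hamming-self (false ∷ u) = hamming-self u
hamming-self (true ∷ u) = hamming-self u

hamming-sym : ∀ {a} (u w : Vec Bool a) → hamming u w ≡ hamming w u
hamming-sym [] [] = refl
hamming-sym (x ∷ u) (y ∷ w) = cong₂ (λ b h → (if b then 1 else 0) + h) (xor-comm x y) (hamming-sym u w)

hamming-complement : ∀ {a} (u w : Vec Bool a) → zipWith _xor_ u w ≡ replicate a true → hamming u w ≡ a
hamming-complement [] [] _ = refl
hamming-complement (x ∷ u) (y ∷ w) u⊕w≡1 with x xor y | Vec.∷-injective u⊕w≡1
... | true | refl , u⊕w≡1′ = cong suc (hamming-complement u w u⊕w≡1′)

module Gray (k : ℕ) (1≤k : 1 ≤ k) (A : Zq k → Vec Bool (2 ^ (k ∸ 1)))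
  (A-distance : (i j : Zq k) → i ≢ j → 2 ^ (k ∸ 1) ≤ 2 * hamming (A i) (A j))
  (A-antipodal : (i j : Zq k) → toℕ i < 2 ^ (k ∸ 1) → toℕ j ≡ toℕ i + 2 ^ (k ∸ 1) →
      zipWith _xor_ (A i) (A j) ≡ replicate _ true) where
  open ZMod k
  open Weight k

  M≡m+m : M ≡ m + m
  M≡m+m = trans (cong (2 ^_) (sym (m+[n∸m]≡n 1≤k))) (cong (m +_) (*-identityˡ m))

  A-injective : ∀ i j → A i ≡ A j → i ≡ j
  A-injective i j Ai≡Aj with i Fin.≟ j
  ... | yes i≡j = i≡j
  ... | no i≢j = ⊥-elim (<⇒≱ m>0 (subst (m ≤_) (cong (2 *_) (trans (cong (hamming (A i)) (sym Ai≡Aj)) (hamming-self (A i))))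
                                                (A-distance i j i≢j)))

  φ-injective : ∀ {n} (x y : Vec (Zq k) n) → φ k A x ≡ φ k A y → x ≡ y
  φ-injective [] [] _ = refl
  φ-injective (i ∷ x) (j ∷ y) φx≡φy with Ai≡Aj , φx≡φy′ ← Vec.++-injective (A i) (A j) φx≡φy =
    cong₂ _∷_ (A-injective i j Ai≡Aj) (φ-injective x y φx≡φy′)

  antipode-toℕ : ∀ i j → subq k j i ≡ [ m ] → toℕ j ≡ (toℕ i + m) % M
  antipode-toℕ i j j-i≡m = begin
    toℕ j                          ≡⟨ cong toℕ (+z-identityʳ j) ⟨
    toℕ (j +z 0z)                  ≡⟨ cong (λ x → toℕ (j +z x)) (-z-inverseˡ i) ⟨
    toℕ (j +z (-z i +z i))         ≡⟨ cong toℕ (+z-assoc j (-z i) i) ⟨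
    toℕ (j +z -z i +z i)           ≡⟨ cong (λ x → toℕ (x +z i)) (trans (sym (subq≡+z-z j i)) j-i≡m) ⟩
    toℕ ([ m ] +z i)               ≡⟨ toℕ-[] _ ⟩
    (toℕ [ m ] + toℕ i) % M        ≡⟨ cong (λ n → (n + toℕ i) % M) (trans (toℕ-[] m) (m<n⇒m%n≡m m<M)) ⟩
    (m + toℕ i) % M                ≡⟨ cong (_% M) (+-comm m (toℕ i)) ⟩
    (toℕ i + m) % M                ∎
    where
    open ≡-Reasoning
    m<M : m < M
    m<M = subst (m <_) (sym M≡m+m) (m<m+n m m>0)

  antipodes : ∀ i j → subq k j i ≡ [ m ] → hamming (A i) (A j) ≡ m
  antipodes i j j-i≡m with toℕ i <? m
  ... | yes i<m = hamming-complement (A i) (A j) (A-antipodal i j i<m (trans (antipode-toℕ i j j-i≡m) (m<n⇒m%n≡m i+m<M)))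
    where
    i+m<M : toℕ i + m < M
    i+m<M = subst (toℕ i + m <_) (sym M≡m+m) (+-monoˡ-< m i<m)
  ... | no i≮m = trans (hamming-sym (A i) (A j)) (hamming-complement (A j) (A i) (A-antipodal j i j<m i≡j+m))
    where
    s : ℕ
    s = toℕ i ∸ m
    i≡s+m : toℕ i ≡ s + m
    i≡s+m = sym (m∸n+n≡m (≮⇒≥ i≮m))
    s<m : s < m
    s<m = +-cancelʳ-< m s m (subst₂ _<_ i≡s+m M≡m+m (toℕ<n i))
    j≡s : toℕ j ≡ s
    j≡s = begin
      toℕ j               ≡⟨ (antipode-toℕ i j j-i≡m) ⟩
      (toℕ i + m) % M     ≡⟨ cong (λ n → (n + m) % M) i≡s+m ⟩
      (s + m + m) % M     ≡⟨ cong (_% M) (trans (+-assoc s m m) (cong (s +_) (sym M≡m+m))) ⟩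
      (s + M) % M         ≡⟨ [m+n]%n≡m%n s M ⟩
      s % M               ≡⟨ m<n⇒m%n≡m (<-≤-trans s<m (subst (m ≤_) (sym M≡m+m) (m≤m+n m m))) ⟩
      s                   ∎
      where open ≡-Reasoning
    j<m : toℕ j < m
    j<m = subst (_< m) (sym j≡s) s<m
    i≡j+m : toℕ i ≡ toℕ j + m
    i≡j+m = trans i≡s+m (cong (_+ m) (sym j≡s))

  wt2≤2*hamming : ∀ i j → wt2 k (subq k j i) ≤ 2 * hamming (A i) (A j)
  wt2≤2*hamming i j = byCases (i Fin.≟ j) (toℕ (subq k j i) ≟ m)
    where
    byCases : Dec (i ≡ j) → Dec (toℕ (subq k j i) ≡ m) → wt2 k (subq k j i) ≤ 2 * hamming (A i) (A j)
    byCases (yes refl) _ = ≤-trans (≤-reflexive (wt2-zero (subq k i i) i-i≡0)) z≤n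
      where
      i-i≡0 : toℕ (subq k i i) ≡ 0
      i-i≡0 = trans (cong toℕ (trans (subq≡+z-z i i) (-z-inverseʳ i))) (trans (toℕ-[] 0) (m<n⇒m%n≡m (m^n>0 2 k)))
    byCases (no i≢j) (no j-i≢m) = ≤-trans (wt2≤m (subq k j i) j-i≢m) (A-distance i j i≢j)
    byCases (no _) (yes j-i≡m) = ≤-trans (wt2≤2m (subq k j i))
      (≤-reflexive (cong (2 *_) (sym (antipodes i j (trans (sym ([]-toℕ (subq k j i))) (cong [_] j-i≡m))))))

  dist2≤2*hamming : ∀ {n} (x y : Vec (Zq k) n) → dist2 k x y ≤ 2 * hamming (φ k A x) (φ k A y)
  dist2≤2*hamming [] [] = z≤n
  dist2≤2*hamming (i ∷ x) (j ∷ y) = begin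
    wt2 k (subq k j i) + dist2 k x y                              ≤⟨ +-mono-≤ (wt2≤2*hamming i j) (dist2≤2*hamming x y) ⟩
    2 * hamming (A i) (A j) + 2 * hamming (φ k A x) (φ k A y)     ≡⟨ *-distribˡ-+ 2 (hamming (A i) (A j)) _ ⟨
    2 * (hamming (A i) (A j) + hamming (φ k A x) (φ k A y))       ≡⟨ cong (2 *_) (hamming-++ (A i) (A j) (φ k A x) (φ k A y)) ⟨
    2 * hamming (φ k A (i ∷ x)) (φ k A (j ∷ y))                   ∎
    where open ≤-Reasoning

levels′-bounds : ∀ s {n} (I : Vec ℕ n) → All (λ j → s ≤ j × j < s + n) (levels' s I)
levels′-bounds s [] = []
levels′-bounds s {suc n} (i ∷ I) = All.++⁺ (repeated i) (All.map shift (levels′-bounds (suc s) I))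
  where
  repeated : ∀ i → All (λ j → s ≤ j × j < s + suc n) (replicateL i s)
  repeated zero = []
  repeated (suc i) = (≤-refl , m<m+n s (s≤s z≤n)) ∷ repeated i
  shift : ∀ {j} → suc s ≤ j × j < suc s + n → s ≤ j × j < s + suc n
  shift {j} (s<j , j<) = ≤-trans (n≤1+n s) s<j , subst (j <_) (sym (+-suc s n)) j<

levels-IsLevel : ∀ {k} (I : Vec ℕ k) → All (Grid.IsLevel k) (levels I)
levels-IsLevel I = All.map (λ (1≤j , j<1+k) → 1≤j , s≤s⁻¹ j<1+k) (levels′-bounds 1 I)

sum-levels′ : ∀ s {n} (I : Vec ℕ n) → sum (levels' s I) ≡ weighted' s I
sum-levels′ s [] = refl
sum-levels′ s (i ∷ I) = trans (sum-++ (replicateL i s) _) (cong₂ _+_ (repeated i) (sum-levels′ (suc s) I))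
  where
  repeated : ∀ i → sum (replicateL i s) ≡ s * i
  repeated zero = sym (*-zeroʳ s)
  repeated (suc i) = trans (cong (s +_) (repeated i)) (sym (*-suc s i))

theorem3 : (k : ℕ) → 1 ≤ k → (r : ℕ) → (I : Vec ℕ k) → weighted I ≡ r →
  (A : Zq k → Vec Bool (2 ^ (k ∸ 1))) →
  ((i j : Zq k) → i ≢ j → 2 ^ (k ∸ 1) ≤ 2 * hamming (A i) (A j)) →
  A (0q k) ≡ replicate _ false →
  ((i j : Zq k) → toℕ i < 2 ^ (k ∸ 1) → toℕ j ≡ toℕ i + 2 ^ (k ∸ 1) →
    zipWith _xor_ (A i) (A j) ≡ replicate _ true) →
  -- code length n = 2^r
  (lenB k I ≡ 2 ^ r)
  -- D_I is linear
  × ((x y : Vec (Zq k) (lenB k I)) → DI k I x → DI k I y → DI k I (vadd k x y))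
  × ((a : Zq k) (x : Vec (Zq k) (lenB k I)) → DI k I x → DI k I (vscale k a x))
  -- B_I is a generator matrix of D_I
  × ((x : Vec (Zq k) (lenB k I)) →
      DI k I x ⇔ ∃ (λ (c : Vec (Zq k) (rowsB I)) → x ≡ vecMat k (columnsB k I) c))
  -- |D_I| = n 2^k, and φ is injective on D_I, so |φ(D_I)| = n 2^k
  × Σ (List (Vec (Zq k) (lenB k I))) (λ L →
      Unique L × ((x : Vec (Zq k) (lenB k I)) → (x ∈ L) ⇔ DI k I x)
      × length L ≡ 2 ^ r * 2 ^ k × Unique (map (φ k A) L))
  -- minimum d*-distance ≥ n 2^{k-2}   (stated doubled: 2 d* ≥ n 2^{k-1})
  × ((x y : Vec (Zq k) (lenB k I)) → DI k I x → DI k I y → x ≢ y →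
      2 ^ r * 2 ^ (k ∸ 1) ≤ dist2 k x y)
  -- minimum Hamming distance of φ(D_I) ≥ n 2^{k-2}   (stated doubled)
  × ((x y : Vec (Zq k) (lenB k I)) → DI k I x → DI k I y → φ k A x ≢ φ k A y →
      2 ^ r * 2 ^ (k ∸ 1) ≤ 2 * hamming (φ k A x) (φ k A y))
theorem3 k 1≤k r I weighted≡r A A-distance _ A-antipodal =
  length≡2^r , Dual-vadd , Dual-vscale , generated ,
  (codewords , codewords-unique , (λ x → mk⇔ codeword⇒Dual Dual⇒codeword) , count ,
   Unique-map⁺-injectiveOn (φ k A) codewords-unique (λ _ _ → φ-injective _ _)) ,
  distance , hamming-distance
  where
  open Grid k using (length-T)
  levels-ok : All (Grid.IsLevel k) (levels I)
  levels-ok = levels-IsLevel I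
  open Generator k levels-ok
  open Distance k levels-ok
  open Gray k 1≤k A A-distance A-antipodal

  sum≡r : sum (levels I) ≡ r
  sum≡r = trans (sum-levels′ 1 I) weighted≡r

  |T|≡2^r : length (tuples k (levels I)) ≡ 2 ^ r
  |T|≡2^r = trans (length-T (levels I)) (cong (2 ^_) sum≡r)

  length≡2^r : lenB k I ≡ 2 ^ r
  length≡2^r = trans (length-map _ (tuples k (levels I))) |T|≡2^r

  generated : ∀ x → Dual x ⇔ ∃ λ c → x ≡ vecMat k columns c
  generated x = mk⇔ (λ x⊥ → let d , cs , _ , x≡ = Dual⇒rowSpace x x⊥ in d ∷ cs , x≡)
                    (λ (c , x≡) → subst Dual (sym x≡) (rowSpace⊆Dual c))

  count : length codewords ≡ 2 ^ r * 2 ^ k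
  count = trans length-codewords (trans (cong (2 ^ k *_) (cong (2 ^_) sum≡r)) (*-comm (2 ^ k) (2 ^ r)))

  distance : ∀ x y → Dual x → Dual y → x ≢ y → 2 ^ r * 2 ^ (k ∸ 1) ≤ dist2 k x y
  distance x y x⊥ y⊥ x≢y = subst (λ n → n * 2 ^ (k ∸ 1) ≤ dist2 k x y) |T|≡2^r (minimum-distance x⊥ y⊥ x≢y)

  hamming-distance : ∀ x y → Dual x → Dual y → φ k A x ≢ φ k A y → 2 ^ r * 2 ^ (k ∸ 1) ≤ 2 * hamming (φ k A x) (φ k A y)
  hamming-distance x y x⊥ y⊥ φx≢φy = ≤-trans (distance x y x⊥ y⊥ (φx≢φy ∘ cong (φ k A))) (dist2≤2*hamming x y)
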